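{- If $\Gamma\vdash t:A$ is derivable in $\mathsf{HA}+\mathsf{NEM}$, then $t\in\mathsf{SN}$, i.e. there is no infinite reduction sequence $t\leadsto t_1\leadsto t_2\leadsto\cdots$.
   Context: Terms of the arithmetical language $\mathcal{L}$ are built from numeric variables $\alpha,\beta,\dots$, $0$ and $\mathsf{S}$; a numeral is a closed term $\mathsf{S}\cdots\mathsf{S}0$. There is a predicate symbol for every primitive recursive relation on $\mathbb{N}$; atomic formulas $\mathsf{P}$ are such symbols applied to terms; for atomic $\mathsf{P}$, $\lnot\mathsf{P}$ denotes the atomic formula of the boolean negation of $\mathsf{P}$. Formulas are built from atomic formulas by $\wedge,\vee,\rightarrow,\forall\alpha^{\mathbb N},\exists\alpha^{\mathbb N}$. Untyped proof terms of $\mathsf{HA}+\mathsf{NEM}$: $t,u,v ::= x \mid tu \mid tm \mid \lambda x\, u \mid \lambda\alpha\, u \mid \langle t,u\rangle \mid \pi_0 u \mid \pi_1 u \mid \mathsf{inj}_0(u)\mid \mathsf{inj}_1(u) \mid t[x.u,y.v] \mid (m,t) \mid t[(\alpha,x).u] \mid \mathsf{E}(u,v) \mid \mathsf{H}^{\mathsf P}_\alpha \mid \mathsf{W}^{\mathsf P}_\alpha \mid \mathsf{True} \mid \mathsf{R}\,u\,v\,m \mid \mathsf{r}\,t_1\dots t_n$, with $m$ terms of $\mathcal{L}$, $x,y$ proof-term variables, $\mathsf{r}$ a constant. Contexts $\Gamma$ are lists $e_1:A_1,\dots,e_n:A_n$ of distinct variables, each a proof-term variable or a hypothesis variable $a,b,\dots$.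 Typing rules: $\Gamma,x:A\vdash x:A$; $\Gamma,a:\forall\alpha^{\mathbb N}\mathsf{P}\vdash \mathsf{H}^{\mathsf P}_\alpha:\forall\alpha^{\mathbb N}\mathsf P$; $\Gamma,a:\exists\alpha^{\mathbb N}\lnot\mathsf P\vdash\mathsf{W}^{\mathsf P}_\alpha:\exists\alpha^{\mathbb N}\lnot\mathsf P$; $\wedge$-intro ($\langle u,t\rangle:A\wedge B$) and $\wedge$-elims ($\pi_0u:A$, $\pi_1u:B$ from $u:A\wedge B$); $\rightarrow$-elim ($tu:B$ from $t:A\rightarrow B$, $u:A$) and $\rightarrow$-intro ($\lambda x\,u:A\rightarrow B$ from $\Gamma,x:A\vdash u:B$); $\vee$-intros ($\mathsf{inj}_0(u):A\vee B$ from $u:A$, $\mathsf{inj}_1(u):A\vee B$ from $u:B$); $\vee$-elim ($u[x.w_1,x.w_2]:C$ from $\Gamma\vdash u:A\vee B$, $\Gamma,x:A\vdash w_1:C$, $\Gamma,x:B\vdash w_2:C$); $\forall$-elim ($um:A[m/\alpha]$ from $u:\forall\alpha^{\mathbb N}A$, $m$ term of $\mathcal L$); $\forall$-intro ($\lambda\alpha\,u:\forall\alpha^{\mathbb N}A$ from $\Gamma\vdash u:A$, $\alpha$ not free in $\Gamma$); $\exists$-intro ($(m,u):\exists\alpha^{\mathbb N}A$ from $u:A[m/\alpha]$); $\exists$-elim ($u[(\alpha,x).t]:C$ from $\Gamma\vdash u:\exists\alpha^{\mathbb N}A$, $\Gamma,x:A\vdash t:C$, $\alpha$ not free in $C$ nor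 $\Gamma$); induction ($\mathsf{R}uvt:A(t)$ from $u:A(0)$, $v:\forall\alpha^{\mathbb N}(A(\alpha)\rightarrow A(\mathsf S\alpha))$, $t$ any term of $\mathcal L$); Post rules: from $\Gamma\vdash u_i:\mathsf{P}_i$ ($i=1..n$) infer $\Gamma\vdash u:\mathsf P$ with $\mathsf P_i,\mathsf P$ atomic such that every closed substitution making all $\mathsf P_i$ true makes $\mathsf P$ true, $u=\mathsf{r}u_1\dots u_n$ if $n>0$, $u=\mathsf{True}$ if $n=0$; $\mathsf{NEM}$: from $\Gamma,a:\forall\alpha^{\mathbb N}\mathsf P\vdash w_1:C$ and $\Gamma,a:\exists\alpha^{\mathbb N}\lnot\mathsf P\vdash w_2:C$ infer $\Gamma\vdash\mathsf{E}(w_1,w_2):C$. The one-step reduction $\leadsto$ is the closure under all term contexts of: $(\lambda x.u)t\leadsto u[t/x]$; $(\lambda\alpha.u)t\leadsto u[t/\alpha]$; $\pi_i\langle u_0,u_1\rangle\leadsto u_i$; $\mathsf{inj}_i(u)[x_0.t_0,x_1.t_1]\leadsto t_i[u/x_i]$; $(n,u)[(\alpha,x).v]\leadsto v[n/\alpha][u/x]$ ($n$ numeral); $\mathsf{R}uv0\leadsto u$; $\mathsf{R}uv(\mathsf{S}n)\leadsto vn(\mathsf{R}uvn)$ ($n$ numeral); $(\mathsf{E}(u,v))w\leadsto \mathsf{E}(uw,vw)$; $\pi_i(\mathsf{E}(u,v))\leadsto\mathsf{E}(\pi_iu,\pi_iv)$; $(\mathsf{E}(u,v))[x.w_1,y.w_2]\leadsto\mathsf{E}(u[x.w_1,y.w_2],v[x.w_1,y.w_2])$;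 $(\mathsf{E}(u,v))[(\alpha,x).w]\leadsto\mathsf{E}(u[(\alpha,x).w],v[(\alpha,x).w])$; $\mathsf{H}^{\mathsf P}_\alpha n\leadsto\mathsf{True}$ if $\mathsf{P}[n/\alpha]$ is true; $\mathsf{W}^{\mathsf P}_\alpha\leadsto(n,\mathsf{True})$ for every numeral $n$; $\mathsf{E}(u,v)\leadsto u$; $\mathsf{E}(u,v)\leadsto v$. $\mathsf{SN}$ is the set of untyped terms with no infinite $\leadsto$-reduction sequence. -}

module Defs where

open import Data.Nat using (ℕ; zero; suc)
open import Data.Fin using (Fin)
open import Data.Vec using (Vec; []; _∷_; lookup) renaming (map to vmap)
open import Data.List using (List; []; _∷_) renaming (map to lmap)
open import Data.List.Membership.Propositional using (_∈_)
open import Data.List.Relation.Unary.All using (All)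
open import Data.Product using (Σ; _×_; _,_)
open import Relation.Binary.PropositionalEquality using (_≡_; _≢_)
open import Relation.Nullary using (¬_)

-- Primitive recursive functions (syntax and semantics).
-- A primitive recursive relation is represented by (a code of) its
-- characteristic function; the relation holds iff the value is ≠ 0.

data PR : ℕ → Set where
  zeroPR : ∀ {n} → PR n
  succPR : PR 1
  projPR : ∀ {n} → Fin n → PR n
  compPR : ∀ {m n} → PR m → Vec (PR n) m → PR n
  recPR  : ∀ {n} → PR n → PR (suc (suc n)) → PR (suc n)

mutual
  evalPR : ∀ {n} → PR n → Vec ℕ n → ℕ
  evalPR zeroPR xs = 0
  evalPR succPR (x ∷ []) = suc x
  evalPR (projPR i) xs = lookup xs i
  evalPR (compPR f gs) xs = evalPR f (evalPRs gs xs)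
  evalPR (recPR g h) (x ∷ xs) = evalRec g h x xs

  evalPRs : ∀ {m n} → Vec (PR n) m → Vec ℕ n → Vec ℕ m
  evalPRs [] xs = []
  evalPRs (g ∷ gs) xs = evalPR g xs ∷ evalPRs gs xs

  evalRec : ∀ {n} → PR n → PR (suc (suc n)) → ℕ → Vec ℕ n → ℕ
  evalRec g h zero xs = evalPR g xs
  evalRec g h (suc x) xs = evalPR h (x ∷ evalRec g h x xs ∷ xs)

-- boolean negation: x ↦ 1 ∸ x
notPR : PR 1
notPR = recPR (compPR succPR (zeroPR ∷ [])) zeroPR

data Tm : Set where
  var : ℕ → Tm
  `0  : Tm
  `S  : Tm → Tm

num : ℕ → Tm
num zero = `0
num (suc k) = `S (num k)

renT : (ℕ → ℕ) → Tm → Tm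
renT ρ (var i) = var (ρ i)
renT ρ `0 = `0
renT ρ (`S m) = `S (renT ρ m)

subT : (ℕ → Tm) → Tm → Tm
subT σ (var i) = σ i
subT σ `0 = `0
subT σ (`S m) = `S (subT σ m)

evalT : (ℕ → ℕ) → Tm → ℕ
evalT ρ (var i) = ρ i
evalT ρ `0 = zero
evalT ρ (`S m) = suc (evalT ρ m)

_∷σ_ : Tm → (ℕ → Tm) → ℕ → Tm
(m ∷σ σ) zero = m
(m ∷σ σ) (suc i) = σ i

idσ : ℕ → Tm
idσ = var

shiftσ : ℕ → Tm
shiftσ i = var (suc i)

liftσ : (ℕ → Tm) → ℕ → Tm
liftσ σ = var 0 ∷σ (λ i → renT suc (σ i))

record Atom : Set where
  constructor atm
  field
    arity : ℕ
    rel   : PR arity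
    args  : Vec Tm arity

subA : (ℕ → Tm) → Atom → Atom
subA σ (atm k f ts) = atm k f (vmap (subT σ) ts)

holds : (ℕ → ℕ) → Atom → Set
holds ρ (atm k f ts) = evalPR f (vmap (evalT ρ) ts) ≢ 0

TrueA : Atom → Set
TrueA P = ∀ ρ → holds ρ P

negA : Atom → Atom
negA (atm k f ts) = atm k (compPR notPR (f ∷ [])) ts

data Fm : Set where
  atom : Atom → Fm
  _∧'_ : Fm → Fm → Fm
  _∨'_ : Fm → Fm → Fm
  _⇒'_ : Fm → Fm → Fm
  all' : Fm → Fm
  ex'  : Fm → Fm

subF : (ℕ → Tm) → Fm → Fm
subF σ (atom P) = atom (subA σ P)
subF σ (A ∧' B) = subF σ A ∧' subF σ B
subF σ (A ∨' B) = subF σ A ∨' subF σ B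
subF σ (A ⇒' B) = subF σ A ⇒' subF σ B
subF σ (all' A) = all' (subF (liftσ σ) A)
subF σ (ex' A) = ex' (subF (liftσ σ) A)

shiftF : Fm → Fm
shiftF = subF shiftσ

instF : Fm → Tm → Fm
instF A m = subF (m ∷σ idσ) A

data PT : Set where
  pv   : ℕ → PT
  app  : PT → PT → PT
  napp : PT → Tm → PT
  lam  : PT → PT
  nlam : PT → PT
  pair : PT → PT → PT
  π₀   : PT → PT
  π₁   : PT → PT
  inj₀ : PT → PT
  inj₁ : PT → PT
  case : PT → PT → PT → PT      -- t[x.u, y.v]   (binds proof index 0 in u and in v)
  wit  : Tm → PT → PT
  exE  : PT → PT → PT           -- t[(α,x).u]    (binds numeric index 0 and proof index 0 in u)
  E    : PT → PT → PT
  H    : Atom → PT              -- H^P_α         (α = numeric index 0 of P)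
  W    : Atom → PT              -- W^P_α         (α = numeric index 0 of P)
  tru  : PT
  R    : PT → PT → Tm → PT
  cst  : ℕ → List PT → PT       -- r t1 … tn   (r a constant, named by a number)

mutual
  nsub : (ℕ → Tm) → PT → PT
  nsub σ (pv x) = pv x
  nsub σ (app t u) = app (nsub σ t) (nsub σ u)
  nsub σ (napp t m) = napp (nsub σ t) (subT σ m)
  nsub σ (lam u) = lam (nsub σ u)
  nsub σ (nlam u) = nlam (nsub (liftσ σ) u)
  nsub σ (pair t u) = pair (nsub σ t) (nsub σ u)
  nsub σ (π₀ u) = π₀ (nsub σ u)
  nsub σ (π₁ u) = π₁ (nsub σ u)
  nsub σ (inj₀ u) = inj₀ (nsub σ u)
  nsub σ (inj₁ u) = inj₁ (nsub σ u)
  nsub σ (case t u v) = case (nsub σ t) (nsub σ u) (nsub σ v)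
  nsub σ (wit m t) = wit (subT σ m) (nsub σ t)
  nsub σ (exE t u) = exE (nsub σ t) (nsub (liftσ σ) u)
  nsub σ (E u v) = E (nsub σ u) (nsub σ v)
  nsub σ (H P) = H (subA (liftσ σ) P)
  nsub σ (W P) = W (subA (liftσ σ) P)
  nsub σ tru = tru
  nsub σ (R u v m) = R (nsub σ u) (nsub σ v) (subT σ m)
  nsub σ (cst c ts) = cst c (nsubs σ ts)

  nsubs : (ℕ → Tm) → List PT → List PT
  nsubs σ [] = []
  nsubs σ (t ∷ ts) = nsub σ t ∷ nsubs σ ts

liftρ : (ℕ → ℕ) → ℕ → ℕ
liftρ ρ zero = zero
liftρ ρ (suc i) = suc (ρ i)

mutual
  pren : (ℕ → ℕ) → PT → PT
  pren ρ (pv x) = pv (ρ x)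
  pren ρ (app t u) = app (pren ρ t) (pren ρ u)
  pren ρ (napp t m) = napp (pren ρ t) m
  pren ρ (lam u) = lam (pren (liftρ ρ) u)
  pren ρ (nlam u) = nlam (pren ρ u)
  pren ρ (pair t u) = pair (pren ρ t) (pren ρ u)
  pren ρ (π₀ u) = π₀ (pren ρ u)
  pren ρ (π₁ u) = π₁ (pren ρ u)
  pren ρ (inj₀ u) = inj₀ (pren ρ u)
  pren ρ (inj₁ u) = inj₁ (pren ρ u)
  pren ρ (case t u v) = case (pren ρ t) (pren (liftρ ρ) u) (pren (liftρ ρ) v)
  pren ρ (wit m t) = wit m (pren ρ t)
  pren ρ (exE t u) = exE (pren ρ t) (pren (liftρ ρ) u)
  pren ρ (E u v) = E (pren ρ u) (pren ρ v)
  pren ρ (H P) = H P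
  pren ρ (W P) = W P
  pren ρ tru = tru
  pren ρ (R u v m) = R (pren ρ u) (pren ρ v) m
  pren ρ (cst c ts) = cst c (prens ρ ts)

  prens : (ℕ → ℕ) → List PT → List PT
  prens ρ [] = []
  prens ρ (t ∷ ts) = pren ρ t ∷ prens ρ ts

_∷ₚ_ : PT → (ℕ → PT) → ℕ → PT
(t ∷ₚ σ) zero = t
(t ∷ₚ σ) (suc i) = σ i

liftP : (ℕ → PT) → ℕ → PT
liftP σ = pv 0 ∷ₚ (λ i → pren suc (σ i))

nliftP : (ℕ → PT) → ℕ → PT
nliftP σ i = nsub shiftσ (σ i)

mutual
  psub : (ℕ → PT) → PT → PT
  psub σ (pv x) = σ x
  psub σ (app t u) = app (psub σ t) (psub σ u)
  psub σ (napp t m) = napp (psub σ t) m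
  psub σ (lam u) = lam (psub (liftP σ) u)
  psub σ (nlam u) = nlam (psub (nliftP σ) u)
  psub σ (pair t u) = pair (psub σ t) (psub σ u)
  psub σ (π₀ u) = π₀ (psub σ u)
  psub σ (π₁ u) = π₁ (psub σ u)
  psub σ (inj₀ u) = inj₀ (psub σ u)
  psub σ (inj₁ u) = inj₁ (psub σ u)
  psub σ (case t u v) = case (psub σ t) (psub (liftP σ) u) (psub (liftP σ) v)
  psub σ (wit m t) = wit m (psub σ t)
  psub σ (exE t u) = exE (psub σ t) (psub (liftP (nliftP σ)) u)
  psub σ (E u v) = E (psub σ u) (psub σ v)
  psub σ (H P) = H P
  psub σ (W P) = W P
  psub σ tru = tru
  psub σ (R u v m) = R (psub σ u) (psub σ v) m
  psub σ (cst c ts) = cst c (psubs σ ts)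

  psubs : (ℕ → PT) → List PT → List PT
  psubs σ [] = []
  psubs σ (t ∷ ts) = psub σ t ∷ psubs σ ts

_[_]ₚ : PT → PT → PT
u [ t ]ₚ = psub (t ∷ₚ pv) u

_[_]ₙ : PT → Tm → PT
u [ m ]ₙ = nsub (m ∷σ idσ) u

infix 4 _↝_ _↝ₗ_

mutual
  data _↝_ : PT → PT → Set where
    β       : ∀ u t → app (lam u) t ↝ u [ t ]ₚ
    βₙ      : ∀ u m → napp (nlam u) m ↝ u [ m ]ₙ
    π₀-pair : ∀ u₀ u₁ → π₀ (pair u₀ u₁) ↝ u₀
    π₁-pair : ∀ u₀ u₁ → π₁ (pair u₀ u₁) ↝ u₁
    case-inj₀ : ∀ u t₀ t₁ → case (inj₀ u) t₀ t₁ ↝ t₀ [ u ]ₚ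
    case-inj₁ : ∀ u t₀ t₁ → case (inj₁ u) t₀ t₁ ↝ t₁ [ u ]ₚ
    ex-wit  : ∀ n u v → exE (wit (num n) u) v ↝ (v [ num n ]ₙ) [ u ]ₚ
    R-0     : ∀ u v → R u v `0 ↝ u
    R-S     : ∀ u v n → R u v (`S (num n)) ↝ app (napp v (num n)) (R u v (num n))
    E-app   : ∀ u v w → app (E u v) w ↝ E (app u w) (app v w)
    E-napp  : ∀ u v m → napp (E u v) m ↝ E (napp u m) (napp v m)
    E-π₀    : ∀ u v → π₀ (E u v) ↝ E (π₀ u) (π₀ v)
    E-π₁    : ∀ u v → π₁ (E u v) ↝ E (π₁ u) (π₁ v)
    E-case  : ∀ u v w₁ w₂ → case (E u v) w₁ w₂ ↝ E (case u w₁ w₂) (case v w₁ w₂)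
    E-exE   : ∀ u v w → exE (E u v) w ↝ E (exE u w) (exE v w)
    H-true  : ∀ P n → TrueA (subA (num n ∷σ idσ) P) → napp (H P) (num n) ↝ tru
    W-wit   : ∀ P n → W P ↝ wit (num n) tru
    E-left  : ∀ u v → E u v ↝ u
    E-right : ∀ u v → E u v ↝ v
    app₁  : ∀ {t t'} u → t ↝ t' → app t u ↝ app t' u
    app₂  : ∀ t {u u'} → u ↝ u' → app t u ↝ app t u'
    napp₁ : ∀ {t t'} m → t ↝ t' → napp t m ↝ napp t' m
    lam₁  : ∀ {u u'} → u ↝ u' → lam u ↝ lam u'
    nlam₁ : ∀ {u u'} → u ↝ u' → nlam u ↝ nlam u'
    pair₁ : ∀ {t t'} u → t ↝ t' → pair t u ↝ pair t' u
    pair₂ : ∀ t {u u'} → u ↝ u' → pair t u ↝ pair t u'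
    π₀₁   : ∀ {u u'} → u ↝ u' → π₀ u ↝ π₀ u'
    π₁₁   : ∀ {u u'} → u ↝ u' → π₁ u ↝ π₁ u'
    inj₀₁ : ∀ {u u'} → u ↝ u' → inj₀ u ↝ inj₀ u'
    inj₁₁ : ∀ {u u'} → u ↝ u' → inj₁ u ↝ inj₁ u'
    case₁ : ∀ {t t'} u v → t ↝ t' → case t u v ↝ case t' u v
    case₂ : ∀ t {u u'} v → u ↝ u' → case t u v ↝ case t u' v
    case₃ : ∀ t u {v v'} → v ↝ v' → case t u v ↝ case t u v'
    wit₁  : ∀ m {t t'} → t ↝ t' → wit m t ↝ wit m t'
    exE₁  : ∀ {t t'} u → t ↝ t' → exE t u ↝ exE t' u
    exE₂  : ∀ t {u u'} → u ↝ u' → exE t u ↝ exE t u'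
    E₁    : ∀ {u u'} v → u ↝ u' → E u v ↝ E u' v
    E₂    : ∀ u {v v'} → v ↝ v' → E u v ↝ E u v'
    R₁    : ∀ {u u'} v m → u ↝ u' → R u v m ↝ R u' v m
    R₂    : ∀ u {v v'} m → v ↝ v' → R u v m ↝ R u v' m
    cst₁  : ∀ c {ts ts'} → ts ↝ₗ ts' → cst c ts ↝ cst c ts'

  data _↝ₗ_ : List PT → List PT → Set where
    here  : ∀ {t t'} ts → t ↝ t' → (t ∷ ts) ↝ₗ (t' ∷ ts)
    there : ∀ t {ts ts'} → ts ↝ₗ ts' → (t ∷ ts) ↝ₗ (t ∷ ts')

SN : PT → Set
SN t = ¬ (Σ (ℕ → PT) λ f → (f 0 ≡ t) × (∀ i → f i ↝ f (suc i)))

-- A context Γ is split into Δ (proof variables, de Bruijn, index 0 = last)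
-- and Θ (hypothesis variables a : ∀α P / a : ∃α ¬P; proof terms never
-- mention them, so only their formulas matter).

data Lookup : List Fm → ℕ → Fm → Set where
  here  : ∀ {Δ A} → Lookup (A ∷ Δ) zero A
  there : ∀ {Δ A B i} → Lookup Δ i A → Lookup (B ∷ Δ) (suc i) A

shiftCtx : List Fm → List Fm
shiftCtx = lmap shiftF

PostValid : List Atom → Atom → Set
PostValid Ps P = ∀ ρ → All (holds ρ) Ps → holds ρ P

postTerm : ℕ → List PT → PT
postTerm c [] = tru
postTerm c (u ∷ us) = cst c (u ∷ us)

mutual
  data Typed (Δ Θ : List Fm) : PT → Fm → Set where
    tvar  : ∀ {i A} → Lookup Δ i A → Typed Δ Θ (pv i) A
    tH    : ∀ {P} → all' (atom P) ∈ Θ → Typed Δ Θ (H P) (all' (atom P))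
    tW    : ∀ {P} → ex' (atom (negA P)) ∈ Θ → Typed Δ Θ (W P) (ex' (atom (negA P)))
    tpair : ∀ {u t A B} → Typed Δ Θ u A → Typed Δ Θ t B → Typed Δ Θ (pair u t) (A ∧' B)
    tπ₀   : ∀ {u A B} → Typed Δ Θ u (A ∧' B) → Typed Δ Θ (π₀ u) A
    tπ₁   : ∀ {u A B} → Typed Δ Θ u (A ∧' B) → Typed Δ Θ (π₁ u) B
    tapp  : ∀ {t u A B} → Typed Δ Θ t (A ⇒' B) → Typed Δ Θ u A → Typed Δ Θ (app t u) B
    tlam  : ∀ {u A B} → Typed (A ∷ Δ) Θ u B → Typed Δ Θ (lam u) (A ⇒' B)
    tinj₀ : ∀ {u A B} → Typed Δ Θ u A → Typed Δ Θ (inj₀ u) (A ∨' B)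
    tinj₁ : ∀ {u A B} → Typed Δ Θ u B → Typed Δ Θ (inj₁ u) (A ∨' B)
    tcase : ∀ {u w₁ w₂ A B C} → Typed Δ Θ u (A ∨' B) →
            Typed (A ∷ Δ) Θ w₁ C → Typed (B ∷ Δ) Θ w₂ C → Typed Δ Θ (case u w₁ w₂) C
    tnapp : ∀ {u A} m → Typed Δ Θ u (all' A) → Typed Δ Θ (napp u m) (instF A m)
    tnlam : ∀ {u A} → Typed (shiftCtx Δ) (shiftCtx Θ) u A → Typed Δ Θ (nlam u) (all' A)
    twit  : ∀ {u A} m → Typed Δ Θ u (instF A m) → Typed Δ Θ (wit m u) (ex' A)
    texE  : ∀ {u t A C} → Typed Δ Θ u (ex' A) →
            Typed (A ∷ shiftCtx Δ) (shiftCtx Θ) t (shiftF C) → Typed Δ Θ (exE u t) C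
    tR    : ∀ {u v A} m → Typed Δ Θ u (instF A `0) →
            Typed Δ Θ v (all' (A ⇒' subF (`S (var 0) ∷σ shiftσ) A)) →
            Typed Δ Θ (R u v m) (instF A m)
    tpost : ∀ {us Ps P} c → TypedL Δ Θ us Ps → PostValid Ps P →
            Typed Δ Θ (postTerm c us) (atom P)
    tNEM  : ∀ {w₁ w₂ C} P → Typed Δ (all' (atom P) ∷ Θ) w₁ C →
            Typed Δ (ex' (atom (negA P)) ∷ Θ) w₂ C → Typed Δ Θ (E w₁ w₂) C

  data TypedL (Δ Θ : List Fm) : List PT → List Atom → Set where
    []  : TypedL Δ Θ [] []
    _∷_ : ∀ {u us P Ps} → Typed Δ Θ u (atom P) → TypedL Δ Θ us Ps → TypedL Δ Θ (u ∷ us) (P ∷ Ps)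

-- Tait–Girard reducibility. Formulas are erased to simple types, and each
-- type is interpreted by a set of strongly normalising terms that is closed
-- under reduction and contains every neutral term all of whose reducts it
-- contains. The new ingredient for NEM is that these sets are closed under
-- E(u,v): an elimination applied to E(u,v) permutes into both branches
-- (landing at a smaller type), selects a branch, or reduces inside one of
-- its arguments, which is handled by induction on strong normalisation.
-- The fundamental lemma then shows that every typed term is reducible under
-- any reducible substitution. The hypothesis constants H and W are reducible
-- outright, their only reducts being True and (n, True), so the hypothesis
-- context is never interpreted.

module Submission where

open import Data.Empty using (⊥; ⊥-elim)
open import Data.List using (List; []; _∷_)
open import Data.List.Relation.Unary.All using (All; []; _∷_)
open import Data.Nat using (ℕ; zero; suc)
open import Data.Product using (_×_; _,_; proj₁; proj₂)
open import Data.Unit using (⊤; tt)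
open import Data.Vec.Properties using (map-cong; map-∘; map-id)
open import Function using (_∘_)
open import Relation.Binary.PropositionalEquality

open import Defs

subT-cong : ∀ {σ σ'} → σ ≗ σ' → ∀ m → subT σ m ≡ subT σ' m
subT-cong e (var i) = e i
subT-cong e `0 = refl
subT-cong e (`S m) = cong `S (subT-cong e m)

subT-id : ∀ m → subT idσ m ≡ m
subT-id (var i) = refl
subT-id `0 = refl
subT-id (`S m) = cong `S (subT-id m)

subT-∘ : ∀ σ τ m → subT σ (subT τ m) ≡ subT (subT σ ∘ τ) m
subT-∘ σ τ (var i) = refl
subT-∘ σ τ `0 = refl
subT-∘ σ τ (`S m) = cong `S (subT-∘ σ τ m)

renT-as-subT : ∀ ρ m → renT ρ m ≡ subT (var ∘ ρ) m
renT-as-subT ρ (var i) = refl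
renT-as-subT ρ `0 = refl
renT-as-subT ρ (`S m) = cong `S (renT-as-subT ρ m)

subT-num : ∀ σ n → subT σ (num n) ≡ num n
subT-num σ zero = refl
subT-num σ (suc n) = cong `S (subT-num σ n)

evalT-subT : ∀ ρ σ m → evalT ρ (subT σ m) ≡ evalT (evalT ρ ∘ σ) m
evalT-subT ρ σ (var i) = refl
evalT-subT ρ σ `0 = refl
evalT-subT ρ σ (`S m) = cong suc (evalT-subT ρ σ m)

subT-liftσ-renT : ∀ σ m → subT (liftσ σ) (renT suc m) ≡ renT suc (subT σ m)
subT-liftσ-renT σ (var i) = refl
subT-liftσ-renT σ `0 = refl
subT-liftσ-renT σ (`S m) = cong `S (subT-liftσ-renT σ m)

subT-∷σ-renT : ∀ m σ k → subT (m ∷σ σ) (renT suc k) ≡ subT σ k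
subT-∷σ-renT m σ (var i) = refl
subT-∷σ-renT m σ `0 = refl
subT-∷σ-renT m σ (`S k) = cong `S (subT-∷σ-renT m σ k)

liftσ-cong : ∀ {σ σ'} → σ ≗ σ' → liftσ σ ≗ liftσ σ'
liftσ-cong e zero = refl
liftσ-cong e (suc i) = cong (renT suc) (e i)

liftσ-id : liftσ idσ ≗ idσ
liftσ-id zero = refl
liftσ-id (suc i) = refl

liftσ-∘ : ∀ σ τ → subT (liftσ σ) ∘ liftσ τ ≗ liftσ (subT σ ∘ τ)
liftσ-∘ σ τ zero = refl
liftσ-∘ σ τ (suc i) = subT-liftσ-renT σ (τ i)

liftσ-shiftσ : ∀ σ → subT (liftσ σ) ∘ shiftσ ≗ subT shiftσ ∘ σ
liftσ-shiftσ σ i = renT-as-subT suc (σ i)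

liftσ-∷σ : ∀ m τ → subT (m ∷σ idσ) ∘ liftσ τ ≗ m ∷σ τ
liftσ-∷σ m τ zero = refl
liftσ-∷σ m τ (suc i) = trans (subT-∷σ-renT m idσ (τ i)) (subT-id (τ i))

∷σ-subT : ∀ ρ m → subT ρ ∘ (m ∷σ idσ) ≗ subT ρ m ∷σ ρ
∷σ-subT ρ m zero = refl
∷σ-subT ρ m (suc i) = refl

liftσ-∷σ-subT : ∀ ρ m → subT (subT ρ m ∷σ idσ) ∘ liftσ ρ ≗ subT ρ ∘ (m ∷σ idσ)
liftσ-∷σ-subT ρ m i = trans (liftσ-∷σ (subT ρ m) ρ i) (sym (∷σ-subT ρ m i))

subA-cong : ∀ {σ σ'} → σ ≗ σ' → ∀ P → subA σ P ≡ subA σ' P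
subA-cong e (atm k f ts) = cong (atm k f) (map-cong (subT-cong e) ts)

subA-id : ∀ P → subA idσ P ≡ P
subA-id (atm k f ts) = cong (atm k f) (trans (map-cong subT-id ts) (map-id ts))

subA-∘ : ∀ σ τ P → subA σ (subA τ P) ≡ subA (subT σ ∘ τ) P
subA-∘ σ τ (atm k f ts) =
  cong (atm k f) (trans (sym (map-∘ (subT σ) (subT τ) ts)) (map-cong (subT-∘ σ τ) ts))

holds-subA : ∀ ρ σ P → holds ρ (subA σ P) ≡ holds (evalT ρ ∘ σ) P
holds-subA ρ σ (atm k f ts) =
  cong (λ v → evalPR f v ≢ 0) (trans (sym (map-∘ (evalT ρ) (subT σ) ts)) (map-cong (evalT-subT ρ σ) ts))

TrueA-subA : ∀ σ P → TrueA P → TrueA (subA σ P)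
TrueA-subA σ P t ρ = subst (λ X → X) (sym (holds-subA ρ σ P)) (t (evalT ρ ∘ σ))

subA-liftσ-[]ₙ : ∀ ρ m P → subA (subT ρ m ∷σ idσ) (subA (liftσ ρ) P) ≡ subA ρ (subA (m ∷σ idσ) P)
subA-liftσ-[]ₙ ρ m P = begin
  subA (subT ρ m ∷σ idσ) (subA (liftσ ρ) P)  ≡⟨ subA-∘ _ _ P ⟩
  subA (subT (subT ρ m ∷σ idσ) ∘ liftσ ρ) P  ≡⟨ subA-cong (liftσ-∷σ-subT ρ m) P ⟩
  subA (subT ρ ∘ (m ∷σ idσ)) P               ≡⟨ sym (subA-∘ _ _ P) ⟩
  subA ρ (subA (m ∷σ idσ) P)                 ∎
  where open ≡-Reasoning

cong₃ : ∀ {A B C D : Set} (f : A → B → C → D) {a a' b b' c c'} →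
        a ≡ a' → b ≡ b' → c ≡ c' → f a b c ≡ f a' b' c'
cong₃ f refl refl refl = refl

mutual
  nsub-cong : ∀ {σ σ'} → σ ≗ σ' → ∀ t → nsub σ t ≡ nsub σ' t
  nsub-cong e (pv x) = refl
  nsub-cong e (app t u) = cong₂ app (nsub-cong e t) (nsub-cong e u)
  nsub-cong e (napp t m) = cong₂ napp (nsub-cong e t) (subT-cong e m)
  nsub-cong e (lam u) = cong lam (nsub-cong e u)
  nsub-cong e (nlam u) = cong nlam (nsub-cong (liftσ-cong e) u)
  nsub-cong e (pair t u) = cong₂ pair (nsub-cong e t) (nsub-cong e u)
  nsub-cong e (π₀ u) = cong π₀ (nsub-cong e u)
  nsub-cong e (π₁ u) = cong π₁ (nsub-cong e u)
  nsub-cong e (inj₀ u) = cong inj₀ (nsub-cong e u)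
  nsub-cong e (inj₁ u) = cong inj₁ (nsub-cong e u)
  nsub-cong e (case t u v) = cong₃ case (nsub-cong e t) (nsub-cong e u) (nsub-cong e v)
  nsub-cong e (wit m t) = cong₂ wit (subT-cong e m) (nsub-cong e t)
  nsub-cong e (exE t u) = cong₂ exE (nsub-cong e t) (nsub-cong (liftσ-cong e) u)
  nsub-cong e (E u v) = cong₂ E (nsub-cong e u) (nsub-cong e v)
  nsub-cong e (H P) = cong H (subA-cong (liftσ-cong e) P)
  nsub-cong e (W P) = cong W (subA-cong (liftσ-cong e) P)
  nsub-cong e tru = refl
  nsub-cong e (R u v m) = cong₃ R (nsub-cong e u) (nsub-cong e v) (subT-cong e m)
  nsub-cong e (cst c ts) = cong (cst c) (nsubs-cong e ts)

  nsubs-cong : ∀ {σ σ'} → σ ≗ σ' → ∀ ts → nsubs σ ts ≡ nsubs σ' ts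
  nsubs-cong e [] = refl
  nsubs-cong e (t ∷ ts) = cong₂ _∷_ (nsub-cong e t) (nsubs-cong e ts)

mutual
  nsub-id : ∀ t → nsub idσ t ≡ t
  nsub-id (pv x) = refl
  nsub-id (app t u) = cong₂ app (nsub-id t) (nsub-id u)
  nsub-id (napp t m) = cong₂ napp (nsub-id t) (subT-id m)
  nsub-id (lam u) = cong lam (nsub-id u)
  nsub-id (nlam u) = cong nlam (trans (nsub-cong liftσ-id u) (nsub-id u))
  nsub-id (pair t u) = cong₂ pair (nsub-id t) (nsub-id u)
  nsub-id (π₀ u) = cong π₀ (nsub-id u)
  nsub-id (π₁ u) = cong π₁ (nsub-id u)
  nsub-id (inj₀ u) = cong inj₀ (nsub-id u)
  nsub-id (inj₁ u) = cong inj₁ (nsub-id u)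
  nsub-id (case t u v) = cong₃ case (nsub-id t) (nsub-id u) (nsub-id v)
  nsub-id (wit m t) = cong₂ wit (subT-id m) (nsub-id t)
  nsub-id (exE t u) = cong₂ exE (nsub-id t) (trans (nsub-cong liftσ-id u) (nsub-id u))
  nsub-id (E u v) = cong₂ E (nsub-id u) (nsub-id v)
  nsub-id (H P) = cong H (trans (subA-cong liftσ-id P) (subA-id P))
  nsub-id (W P) = cong W (trans (subA-cong liftσ-id P) (subA-id P))
  nsub-id tru = refl
  nsub-id (R u v m) = cong₃ R (nsub-id u) (nsub-id v) (subT-id m)
  nsub-id (cst c ts) = cong (cst c) (nsubs-id ts)

  nsubs-id : ∀ ts → nsubs idσ ts ≡ ts
  nsubs-id [] = refl
  nsubs-id (t ∷ ts) = cong₂ _∷_ (nsub-id t) (nsubs-id ts)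

mutual
  nsub-∘ : ∀ σ τ t → nsub σ (nsub τ t) ≡ nsub (subT σ ∘ τ) t
  nsub-∘ σ τ (pv x) = refl
  nsub-∘ σ τ (app t u) = cong₂ app (nsub-∘ σ τ t) (nsub-∘ σ τ u)
  nsub-∘ σ τ (napp t m) = cong₂ napp (nsub-∘ σ τ t) (subT-∘ σ τ m)
  nsub-∘ σ τ (lam u) = cong lam (nsub-∘ σ τ u)
  nsub-∘ σ τ (nlam u) = cong nlam (trans (nsub-∘ _ _ u) (nsub-cong (liftσ-∘ σ τ) u))
  nsub-∘ σ τ (pair t u) = cong₂ pair (nsub-∘ σ τ t) (nsub-∘ σ τ u)
  nsub-∘ σ τ (π₀ u) = cong π₀ (nsub-∘ σ τ u)
  nsub-∘ σ τ (π₁ u) = cong π₁ (nsub-∘ σ τ u)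
  nsub-∘ σ τ (inj₀ u) = cong inj₀ (nsub-∘ σ τ u)
  nsub-∘ σ τ (inj₁ u) = cong inj₁ (nsub-∘ σ τ u)
  nsub-∘ σ τ (case t u v) = cong₃ case (nsub-∘ σ τ t) (nsub-∘ σ τ u) (nsub-∘ σ τ v)
  nsub-∘ σ τ (wit m t) = cong₂ wit (subT-∘ σ τ m) (nsub-∘ σ τ t)
  nsub-∘ σ τ (exE t u) = cong₂ exE (nsub-∘ σ τ t) (trans (nsub-∘ _ _ u) (nsub-cong (liftσ-∘ σ τ) u))
  nsub-∘ σ τ (E u v) = cong₂ E (nsub-∘ σ τ u) (nsub-∘ σ τ v)
  nsub-∘ σ τ (H P) = cong H (trans (subA-∘ _ _ P) (subA-cong (liftσ-∘ σ τ) P))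
  nsub-∘ σ τ (W P) = cong W (trans (subA-∘ _ _ P) (subA-cong (liftσ-∘ σ τ) P))
  nsub-∘ σ τ tru = refl
  nsub-∘ σ τ (R u v m) = cong₃ R (nsub-∘ σ τ u) (nsub-∘ σ τ v) (subT-∘ σ τ m)
  nsub-∘ σ τ (cst c ts) = cong (cst c) (nsubs-∘ σ τ ts)

  nsubs-∘ : ∀ σ τ ts → nsubs σ (nsubs τ ts) ≡ nsubs (subT σ ∘ τ) ts
  nsubs-∘ σ τ [] = refl
  nsubs-∘ σ τ (t ∷ ts) = cong₂ _∷_ (nsub-∘ σ τ t) (nsubs-∘ σ τ ts)

[]ₙ-liftσ : ∀ m τ u → (nsub (liftσ τ) u) [ m ]ₙ ≡ nsub (m ∷σ τ) u
[]ₙ-liftσ m τ u = trans (nsub-∘ _ _ u) (nsub-cong (liftσ-∷σ m τ) u)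

[]ₙ-shiftσ : ∀ m t → (nsub shiftσ t) [ m ]ₙ ≡ t
[]ₙ-shiftσ m t = trans (nsub-∘ _ _ t) (nsub-id t)

nsub-[]ₙ : ∀ ρ m u → (nsub (liftσ ρ) u) [ subT ρ m ]ₙ ≡ nsub ρ (u [ m ]ₙ)
nsub-[]ₙ ρ m u = trans (nsub-∘ _ _ u) (trans (nsub-cong (liftσ-∷σ-subT ρ m) u) (sym (nsub-∘ _ _ u)))

nsub-liftσ-shiftσ : ∀ ρ t → nsub (liftσ ρ) (nsub shiftσ t) ≡ nsub shiftσ (nsub ρ t)
nsub-liftσ-shiftσ ρ t = trans (nsub-∘ _ _ t) (trans (nsub-cong (liftσ-shiftσ ρ) t) (sym (nsub-∘ _ _ t)))

liftρ-cong : ∀ {ρ ρ'} → ρ ≗ ρ' → liftρ ρ ≗ liftρ ρ'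
liftρ-cong e zero = refl
liftρ-cong e (suc i) = cong suc (e i)

liftρ-∘ : ∀ ρ ρ' → liftρ ρ ∘ liftρ ρ' ≗ liftρ (ρ ∘ ρ')
liftρ-∘ ρ ρ' zero = refl
liftρ-∘ ρ ρ' (suc i) = refl

mutual
  pren-cong : ∀ {ρ ρ'} → ρ ≗ ρ' → ∀ t → pren ρ t ≡ pren ρ' t
  pren-cong e (pv x) = cong pv (e x)
  pren-cong e (app t u) = cong₂ app (pren-cong e t) (pren-cong e u)
  pren-cong e (napp t m) = cong₂ napp (pren-cong e t) refl
  pren-cong e (lam u) = cong lam (pren-cong (liftρ-cong e) u)
  pren-cong e (nlam u) = cong nlam (pren-cong e u)
  pren-cong e (pair t u) = cong₂ pair (pren-cong e t) (pren-cong e u)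
  pren-cong e (π₀ u) = cong π₀ (pren-cong e u)
  pren-cong e (π₁ u) = cong π₁ (pren-cong e u)
  pren-cong e (inj₀ u) = cong inj₀ (pren-cong e u)
  pren-cong e (inj₁ u) = cong inj₁ (pren-cong e u)
  pren-cong e (case t u v) =
    cong₃ case (pren-cong e t) (pren-cong (liftρ-cong e) u) (pren-cong (liftρ-cong e) v)
  pren-cong e (wit m t) = cong₂ wit refl (pren-cong e t)
  pren-cong e (exE t u) = cong₂ exE (pren-cong e t) (pren-cong (liftρ-cong e) u)
  pren-cong e (E u v) = cong₂ E (pren-cong e u) (pren-cong e v)
  pren-cong e (H P) = refl
  pren-cong e (W P) = refl
  pren-cong e tru = refl
  pren-cong e (R u v m) = cong₃ R (pren-cong e u) (pren-cong e v) refl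
  pren-cong e (cst c ts) = cong (cst c) (prens-cong e ts)

  prens-cong : ∀ {ρ ρ'} → ρ ≗ ρ' → ∀ ts → prens ρ ts ≡ prens ρ' ts
  prens-cong e [] = refl
  prens-cong e (t ∷ ts) = cong₂ _∷_ (pren-cong e t) (prens-cong e ts)

mutual
  pren-∘ : ∀ ρ ρ' t → pren ρ (pren ρ' t) ≡ pren (ρ ∘ ρ') t
  pren-∘ ρ ρ' (pv x) = refl
  pren-∘ ρ ρ' (app t u) = cong₂ app (pren-∘ ρ ρ' t) (pren-∘ ρ ρ' u)
  pren-∘ ρ ρ' (napp t m) = cong₂ napp (pren-∘ ρ ρ' t) refl
  pren-∘ ρ ρ' (lam u) = cong lam (trans (pren-∘ _ _ u) (pren-cong (liftρ-∘ ρ ρ') u))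
  pren-∘ ρ ρ' (nlam u) = cong nlam (pren-∘ ρ ρ' u)
  pren-∘ ρ ρ' (pair t u) = cong₂ pair (pren-∘ ρ ρ' t) (pren-∘ ρ ρ' u)
  pren-∘ ρ ρ' (π₀ u) = cong π₀ (pren-∘ ρ ρ' u)
  pren-∘ ρ ρ' (π₁ u) = cong π₁ (pren-∘ ρ ρ' u)
  pren-∘ ρ ρ' (inj₀ u) = cong inj₀ (pren-∘ ρ ρ' u)
  pren-∘ ρ ρ' (inj₁ u) = cong inj₁ (pren-∘ ρ ρ' u)
  pren-∘ ρ ρ' (case t u v) = cong₃ case (pren-∘ ρ ρ' t)
    (trans (pren-∘ _ _ u) (pren-cong (liftρ-∘ ρ ρ') u))
    (trans (pren-∘ _ _ v) (pren-cong (liftρ-∘ ρ ρ') v))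
  pren-∘ ρ ρ' (wit m t) = cong₂ wit refl (pren-∘ ρ ρ' t)
  pren-∘ ρ ρ' (exE t u) = cong₂ exE (pren-∘ ρ ρ' t) (trans (pren-∘ _ _ u) (pren-cong (liftρ-∘ ρ ρ') u))
  pren-∘ ρ ρ' (E u v) = cong₂ E (pren-∘ ρ ρ' u) (pren-∘ ρ ρ' v)
  pren-∘ ρ ρ' (H P) = refl
  pren-∘ ρ ρ' (W P) = refl
  pren-∘ ρ ρ' tru = refl
  pren-∘ ρ ρ' (R u v m) = cong₃ R (pren-∘ ρ ρ' u) (pren-∘ ρ ρ' v) refl
  pren-∘ ρ ρ' (cst c ts) = cong (cst c) (prens-∘ ρ ρ' ts)

  prens-∘ : ∀ ρ ρ' ts → prens ρ (prens ρ' ts) ≡ prens (ρ ∘ ρ') ts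
  prens-∘ ρ ρ' [] = refl
  prens-∘ ρ ρ' (t ∷ ts) = cong₂ _∷_ (pren-∘ ρ ρ' t) (prens-∘ ρ ρ' ts)

mutual
  pren-nsub : ∀ ρ σ t → pren ρ (nsub σ t) ≡ nsub σ (pren ρ t)
  pren-nsub ρ σ (pv x) = refl
  pren-nsub ρ σ (app t u) = cong₂ app (pren-nsub ρ σ t) (pren-nsub ρ σ u)
  pren-nsub ρ σ (napp t m) = cong₂ napp (pren-nsub ρ σ t) refl
  pren-nsub ρ σ (lam u) = cong lam (pren-nsub _ σ u)
  pren-nsub ρ σ (nlam u) = cong nlam (pren-nsub ρ _ u)
  pren-nsub ρ σ (pair t u) = cong₂ pair (pren-nsub ρ σ t) (pren-nsub ρ σ u)
  pren-nsub ρ σ (π₀ u) = cong π₀ (pren-nsub ρ σ u)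
  pren-nsub ρ σ (π₁ u) = cong π₁ (pren-nsub ρ σ u)
  pren-nsub ρ σ (inj₀ u) = cong inj₀ (pren-nsub ρ σ u)
  pren-nsub ρ σ (inj₁ u) = cong inj₁ (pren-nsub ρ σ u)
  pren-nsub ρ σ (case t u v) = cong₃ case (pren-nsub ρ σ t) (pren-nsub _ σ u) (pren-nsub _ σ v)
  pren-nsub ρ σ (wit m t) = cong₂ wit refl (pren-nsub ρ σ t)
  pren-nsub ρ σ (exE t u) = cong₂ exE (pren-nsub ρ σ t) (pren-nsub _ _ u)
  pren-nsub ρ σ (E u v) = cong₂ E (pren-nsub ρ σ u) (pren-nsub ρ σ v)
  pren-nsub ρ σ (H P) = refl
  pren-nsub ρ σ (W P) = refl
  pren-nsub ρ σ tru = refl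
  pren-nsub ρ σ (R u v m) = cong₃ R (pren-nsub ρ σ u) (pren-nsub ρ σ v) refl
  pren-nsub ρ σ (cst c ts) = cong (cst c) (prens-nsubs ρ σ ts)

  prens-nsubs : ∀ ρ σ ts → prens ρ (nsubs σ ts) ≡ nsubs σ (prens ρ ts)
  prens-nsubs ρ σ [] = refl
  prens-nsubs ρ σ (t ∷ ts) = cong₂ _∷_ (pren-nsub ρ σ t) (prens-nsubs ρ σ ts)

liftP-cong : ∀ {σ σ'} → σ ≗ σ' → liftP σ ≗ liftP σ'
liftP-cong e zero = refl
liftP-cong e (suc i) = cong (pren suc) (e i)

nliftP-cong : ∀ {σ σ'} → σ ≗ σ' → nliftP σ ≗ nliftP σ'
nliftP-cong e i = cong (nsub shiftσ) (e i)

mutual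
  psub-cong : ∀ {σ σ'} → σ ≗ σ' → ∀ t → psub σ t ≡ psub σ' t
  psub-cong e (pv x) = e x
  psub-cong e (app t u) = cong₂ app (psub-cong e t) (psub-cong e u)
  psub-cong e (napp t m) = cong₂ napp (psub-cong e t) refl
  psub-cong e (lam u) = cong lam (psub-cong (liftP-cong e) u)
  psub-cong e (nlam u) = cong nlam (psub-cong (nliftP-cong e) u)
  psub-cong e (pair t u) = cong₂ pair (psub-cong e t) (psub-cong e u)
  psub-cong e (π₀ u) = cong π₀ (psub-cong e u)
  psub-cong e (π₁ u) = cong π₁ (psub-cong e u)
  psub-cong e (inj₀ u) = cong inj₀ (psub-cong e u)
  psub-cong e (inj₁ u) = cong inj₁ (psub-cong e u)
  psub-cong e (case t u v) =
    cong₃ case (psub-cong e t) (psub-cong (liftP-cong e) u) (psub-cong (liftP-cong e) v)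
  psub-cong e (wit m t) = cong₂ wit refl (psub-cong e t)
  psub-cong e (exE t u) = cong₂ exE (psub-cong e t) (psub-cong (liftP-cong (nliftP-cong e)) u)
  psub-cong e (E u v) = cong₂ E (psub-cong e u) (psub-cong e v)
  psub-cong e (H P) = refl
  psub-cong e (W P) = refl
  psub-cong e tru = refl
  psub-cong e (R u v m) = cong₃ R (psub-cong e u) (psub-cong e v) refl
  psub-cong e (cst c ts) = cong (cst c) (psubs-cong e ts)

  psubs-cong : ∀ {σ σ'} → σ ≗ σ' → ∀ ts → psubs σ ts ≡ psubs σ' ts
  psubs-cong e [] = refl
  psubs-cong e (t ∷ ts) = cong₂ _∷_ (psub-cong e t) (psubs-cong e ts)

liftP-pv : liftP pv ≗ pv
liftP-pv zero = refl
liftP-pv (suc i) = refl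

liftP-nliftP-pv : liftP (nliftP pv) ≗ pv
liftP-nliftP-pv zero = refl
liftP-nliftP-pv (suc i) = refl

mutual
  psub-id : ∀ t → psub pv t ≡ t
  psub-id (pv x) = refl
  psub-id (app t u) = cong₂ app (psub-id t) (psub-id u)
  psub-id (napp t m) = cong₂ napp (psub-id t) refl
  psub-id (lam u) = cong lam (trans (psub-cong liftP-pv u) (psub-id u))
  psub-id (nlam u) = cong nlam (psub-id u)
  psub-id (pair t u) = cong₂ pair (psub-id t) (psub-id u)
  psub-id (π₀ u) = cong π₀ (psub-id u)
  psub-id (π₁ u) = cong π₁ (psub-id u)
  psub-id (inj₀ u) = cong inj₀ (psub-id u)
  psub-id (inj₁ u) = cong inj₁ (psub-id u)
  psub-id (case t u v) =
    cong₃ case (psub-id t) (trans (psub-cong liftP-pv u) (psub-id u)) (trans (psub-cong liftP-pv v) (psub-id v))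
  psub-id (wit m t) = cong₂ wit refl (psub-id t)
  psub-id (exE t u) = cong₂ exE (psub-id t) (trans (psub-cong liftP-nliftP-pv u) (psub-id u))
  psub-id (E u v) = cong₂ E (psub-id u) (psub-id v)
  psub-id (H P) = refl
  psub-id (W P) = refl
  psub-id tru = refl
  psub-id (R u v m) = cong₃ R (psub-id u) (psub-id v) refl
  psub-id (cst c ts) = cong (cst c) (psubs-id ts)

  psubs-id : ∀ ts → psubs pv ts ≡ ts
  psubs-id [] = refl
  psubs-id (t ∷ ts) = cong₂ _∷_ (psub-id t) (psubs-id ts)

liftP-liftρ : ∀ σ ρ → liftP σ ∘ liftρ ρ ≗ liftP (σ ∘ ρ)
liftP-liftρ σ ρ zero = refl
liftP-liftρ σ ρ (suc i) = refl

mutual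
  psub-pren : ∀ σ ρ t → psub σ (pren ρ t) ≡ psub (σ ∘ ρ) t
  psub-pren σ ρ (pv x) = refl
  psub-pren σ ρ (app t u) = cong₂ app (psub-pren σ ρ t) (psub-pren σ ρ u)
  psub-pren σ ρ (napp t m) = cong₂ napp (psub-pren σ ρ t) refl
  psub-pren σ ρ (lam u) = cong lam (trans (psub-pren _ _ u) (psub-cong (liftP-liftρ σ ρ) u))
  psub-pren σ ρ (nlam u) = cong nlam (psub-pren _ ρ u)
  psub-pren σ ρ (pair t u) = cong₂ pair (psub-pren σ ρ t) (psub-pren σ ρ u)
  psub-pren σ ρ (π₀ u) = cong π₀ (psub-pren σ ρ u)
  psub-pren σ ρ (π₁ u) = cong π₁ (psub-pren σ ρ u)
  psub-pren σ ρ (inj₀ u) = cong inj₀ (psub-pren σ ρ u)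
  psub-pren σ ρ (inj₁ u) = cong inj₁ (psub-pren σ ρ u)
  psub-pren σ ρ (case t u v) = cong₃ case (psub-pren σ ρ t)
    (trans (psub-pren _ _ u) (psub-cong (liftP-liftρ σ ρ) u))
    (trans (psub-pren _ _ v) (psub-cong (liftP-liftρ σ ρ) v))
  psub-pren σ ρ (wit m t) = cong₂ wit refl (psub-pren σ ρ t)
  psub-pren σ ρ (exE t u) =
    cong₂ exE (psub-pren σ ρ t) (trans (psub-pren _ _ u) (psub-cong (liftP-liftρ (nliftP σ) ρ) u))
  psub-pren σ ρ (E u v) = cong₂ E (psub-pren σ ρ u) (psub-pren σ ρ v)
  psub-pren σ ρ (H P) = refl
  psub-pren σ ρ (W P) = refl
  psub-pren σ ρ tru = refl
  psub-pren σ ρ (R u v m) = cong₃ R (psub-pren σ ρ u) (psub-pren σ ρ v) refl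
  psub-pren σ ρ (cst c ts) = cong (cst c) (psubs-prens σ ρ ts)

  psubs-prens : ∀ σ ρ ts → psubs σ (prens ρ ts) ≡ psubs (σ ∘ ρ) ts
  psubs-prens σ ρ [] = refl
  psubs-prens σ ρ (t ∷ ts) = cong₂ _∷_ (psub-pren σ ρ t) (psubs-prens σ ρ ts)

pren-liftP : ∀ ρ σ → pren (liftρ ρ) ∘ liftP σ ≗ liftP (pren ρ ∘ σ)
pren-liftP ρ σ zero = refl
pren-liftP ρ σ (suc i) = trans (pren-∘ _ _ (σ i)) (sym (pren-∘ _ _ (σ i)))

pren-nliftP : ∀ ρ σ → pren ρ ∘ nliftP σ ≗ nliftP (pren ρ ∘ σ)
pren-nliftP ρ σ i = pren-nsub ρ shiftσ (σ i)

mutual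
  pren-psub : ∀ ρ σ t → pren ρ (psub σ t) ≡ psub (pren ρ ∘ σ) t
  pren-psub ρ σ (pv x) = refl
  pren-psub ρ σ (app t u) = cong₂ app (pren-psub ρ σ t) (pren-psub ρ σ u)
  pren-psub ρ σ (napp t m) = cong₂ napp (pren-psub ρ σ t) refl
  pren-psub ρ σ (lam u) = cong lam (trans (pren-psub _ _ u) (psub-cong (pren-liftP ρ σ) u))
  pren-psub ρ σ (nlam u) = cong nlam (trans (pren-psub _ _ u) (psub-cong (pren-nliftP ρ σ) u))
  pren-psub ρ σ (pair t u) = cong₂ pair (pren-psub ρ σ t) (pren-psub ρ σ u)
  pren-psub ρ σ (π₀ u) = cong π₀ (pren-psub ρ σ u)
  pren-psub ρ σ (π₁ u) = cong π₁ (pren-psub ρ σ u)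
  pren-psub ρ σ (inj₀ u) = cong inj₀ (pren-psub ρ σ u)
  pren-psub ρ σ (inj₁ u) = cong inj₁ (pren-psub ρ σ u)
  pren-psub ρ σ (case t u v) = cong₃ case (pren-psub ρ σ t)
    (trans (pren-psub _ _ u) (psub-cong (pren-liftP ρ σ) u))
    (trans (pren-psub _ _ v) (psub-cong (pren-liftP ρ σ) v))
  pren-psub ρ σ (wit m t) = cong₂ wit refl (pren-psub ρ σ t)
  pren-psub ρ σ (exE t u) = cong₂ exE (pren-psub ρ σ t) (trans (pren-psub _ _ u) (psub-cong lift u))
    where
      lift : pren (liftρ ρ) ∘ liftP (nliftP σ) ≗ liftP (nliftP (pren ρ ∘ σ))
      lift i = trans (pren-liftP ρ (nliftP σ) i) (liftP-cong (pren-nliftP ρ σ) i)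
  pren-psub ρ σ (E u v) = cong₂ E (pren-psub ρ σ u) (pren-psub ρ σ v)
  pren-psub ρ σ (H P) = refl
  pren-psub ρ σ (W P) = refl
  pren-psub ρ σ tru = refl
  pren-psub ρ σ (R u v m) = cong₃ R (pren-psub ρ σ u) (pren-psub ρ σ v) refl
  pren-psub ρ σ (cst c ts) = cong (cst c) (prens-psubs ρ σ ts)

  prens-psubs : ∀ ρ σ ts → prens ρ (psubs σ ts) ≡ psubs (pren ρ ∘ σ) ts
  prens-psubs ρ σ [] = refl
  prens-psubs ρ σ (t ∷ ts) = cong₂ _∷_ (pren-psub ρ σ t) (prens-psubs ρ σ ts)

nsub-liftP : ∀ ρ σ → nsub ρ ∘ liftP σ ≗ liftP (nsub ρ ∘ σ)
nsub-liftP ρ σ zero = refl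
nsub-liftP ρ σ (suc i) = sym (pren-nsub suc ρ (σ i))

nsub-nliftP : ∀ ρ σ → nsub (liftσ ρ) ∘ nliftP σ ≗ nliftP (nsub ρ ∘ σ)
nsub-nliftP ρ σ i = nsub-liftσ-shiftσ ρ (σ i)

mutual
  nsub-psub : ∀ ρ σ t → nsub ρ (psub σ t) ≡ psub (nsub ρ ∘ σ) (nsub ρ t)
  nsub-psub ρ σ (pv x) = refl
  nsub-psub ρ σ (app t u) = cong₂ app (nsub-psub ρ σ t) (nsub-psub ρ σ u)
  nsub-psub ρ σ (napp t m) = cong₂ napp (nsub-psub ρ σ t) refl
  nsub-psub ρ σ (lam u) = cong lam (trans (nsub-psub _ _ u) (psub-cong (nsub-liftP ρ σ) (nsub ρ u)))
  nsub-psub ρ σ (nlam u) =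
    cong nlam (trans (nsub-psub _ _ u) (psub-cong (nsub-nliftP ρ σ) (nsub (liftσ ρ) u)))
  nsub-psub ρ σ (pair t u) = cong₂ pair (nsub-psub ρ σ t) (nsub-psub ρ σ u)
  nsub-psub ρ σ (π₀ u) = cong π₀ (nsub-psub ρ σ u)
  nsub-psub ρ σ (π₁ u) = cong π₁ (nsub-psub ρ σ u)
  nsub-psub ρ σ (inj₀ u) = cong inj₀ (nsub-psub ρ σ u)
  nsub-psub ρ σ (inj₁ u) = cong inj₁ (nsub-psub ρ σ u)
  nsub-psub ρ σ (case t u v) = cong₃ case (nsub-psub ρ σ t)
    (trans (nsub-psub _ _ u) (psub-cong (nsub-liftP ρ σ) (nsub ρ u)))
    (trans (nsub-psub _ _ v) (psub-cong (nsub-liftP ρ σ) (nsub ρ v)))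
  nsub-psub ρ σ (wit m t) = cong₂ wit refl (nsub-psub ρ σ t)
  nsub-psub ρ σ (exE t u) =
    cong₂ exE (nsub-psub ρ σ t) (trans (nsub-psub _ _ u) (psub-cong lift (nsub (liftσ ρ) u)))
    where
      lift : nsub (liftσ ρ) ∘ liftP (nliftP σ) ≗ liftP (nliftP (nsub ρ ∘ σ))
      lift i = trans (nsub-liftP (liftσ ρ) (nliftP σ) i) (liftP-cong (nsub-nliftP ρ σ) i)
  nsub-psub ρ σ (E u v) = cong₂ E (nsub-psub ρ σ u) (nsub-psub ρ σ v)
  nsub-psub ρ σ (H P) = refl
  nsub-psub ρ σ (W P) = refl
  nsub-psub ρ σ tru = refl
  nsub-psub ρ σ (R u v m) = cong₃ R (nsub-psub ρ σ u) (nsub-psub ρ σ v) refl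
  nsub-psub ρ σ (cst c ts) = cong (cst c) (nsubs-psubs ρ σ ts)

  nsubs-psubs : ∀ ρ σ ts → nsubs ρ (psubs σ ts) ≡ psubs (nsub ρ ∘ σ) (nsubs ρ ts)
  nsubs-psubs ρ σ [] = refl
  nsubs-psubs ρ σ (t ∷ ts) = cong₂ _∷_ (nsub-psub ρ σ t) (nsubs-psubs ρ σ ts)

psub-liftP : ∀ σ τ → psub (liftP σ) ∘ liftP τ ≗ liftP (psub σ ∘ τ)
psub-liftP σ τ zero = refl
psub-liftP σ τ (suc i) = trans (psub-pren _ _ (τ i)) (sym (pren-psub _ _ (τ i)))

psub-nliftP : ∀ σ τ → psub (nliftP σ) ∘ nliftP τ ≗ nliftP (psub σ ∘ τ)
psub-nliftP σ τ i = sym (nsub-psub shiftσ σ (τ i))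

mutual
  psub-∘ : ∀ σ τ t → psub σ (psub τ t) ≡ psub (psub σ ∘ τ) t
  psub-∘ σ τ (pv x) = refl
  psub-∘ σ τ (app t u) = cong₂ app (psub-∘ σ τ t) (psub-∘ σ τ u)
  psub-∘ σ τ (napp t m) = cong₂ napp (psub-∘ σ τ t) refl
  psub-∘ σ τ (lam u) = cong lam (trans (psub-∘ _ _ u) (psub-cong (psub-liftP σ τ) u))
  psub-∘ σ τ (nlam u) = cong nlam (trans (psub-∘ _ _ u) (psub-cong (psub-nliftP σ τ) u))
  psub-∘ σ τ (pair t u) = cong₂ pair (psub-∘ σ τ t) (psub-∘ σ τ u)
  psub-∘ σ τ (π₀ u) = cong π₀ (psub-∘ σ τ u)
  psub-∘ σ τ (π₁ u) = cong π₁ (psub-∘ σ τ u)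
  psub-∘ σ τ (inj₀ u) = cong inj₀ (psub-∘ σ τ u)
  psub-∘ σ τ (inj₁ u) = cong inj₁ (psub-∘ σ τ u)
  psub-∘ σ τ (case t u v) = cong₃ case (psub-∘ σ τ t)
    (trans (psub-∘ _ _ u) (psub-cong (psub-liftP σ τ) u))
    (trans (psub-∘ _ _ v) (psub-cong (psub-liftP σ τ) v))
  psub-∘ σ τ (wit m t) = cong₂ wit refl (psub-∘ σ τ t)
  psub-∘ σ τ (exE t u) = cong₂ exE (psub-∘ σ τ t) (trans (psub-∘ _ _ u) (psub-cong lift u))
    where
      lift : psub (liftP (nliftP σ)) ∘ liftP (nliftP τ) ≗ liftP (nliftP (psub σ ∘ τ))
      lift i = trans (psub-liftP (nliftP σ) (nliftP τ) i) (liftP-cong (psub-nliftP σ τ) i)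
  psub-∘ σ τ (E u v) = cong₂ E (psub-∘ σ τ u) (psub-∘ σ τ v)
  psub-∘ σ τ (H P) = refl
  psub-∘ σ τ (W P) = refl
  psub-∘ σ τ tru = refl
  psub-∘ σ τ (R u v m) = cong₃ R (psub-∘ σ τ u) (psub-∘ σ τ v) refl
  psub-∘ σ τ (cst c ts) = cong (cst c) (psubs-∘ σ τ ts)

  psubs-∘ : ∀ σ τ ts → psubs σ (psubs τ ts) ≡ psubs (psub σ ∘ τ) ts
  psubs-∘ σ τ [] = refl
  psubs-∘ σ τ (t ∷ ts) = cong₂ _∷_ (psub-∘ σ τ t) (psubs-∘ σ τ ts)

[]ₚ-liftP : ∀ σ u s → (psub (liftP σ) u) [ s ]ₚ ≡ psub (s ∷ₚ σ) u
[]ₚ-liftP σ u s = trans (psub-∘ _ _ u) (psub-cong cons u)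
  where
    cons : psub (s ∷ₚ pv) ∘ liftP σ ≗ s ∷ₚ σ
    cons zero = refl
    cons (suc i) = trans (psub-pren _ _ (σ i)) (psub-id (σ i))

psub-[]ₚ : ∀ σ u t → (psub (liftP σ) u) [ psub σ t ]ₚ ≡ psub σ (u [ t ]ₚ)
psub-[]ₚ σ u t = trans ([]ₚ-liftP σ u (psub σ t)) (sym (trans (psub-∘ _ _ u) (psub-cong cons u)))
  where
    cons : psub σ ∘ (t ∷ₚ pv) ≗ psub σ t ∷ₚ σ
    cons zero = refl
    cons (suc i) = refl

nsub-[]ₚ : ∀ ρ u t → (nsub ρ u) [ nsub ρ t ]ₚ ≡ nsub ρ (u [ t ]ₚ)
nsub-[]ₚ ρ u t = sym (trans (nsub-psub _ _ u) (psub-cong cons (nsub ρ u)))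
  where
    cons : nsub ρ ∘ (t ∷ₚ pv) ≗ nsub ρ t ∷ₚ pv
    cons zero = refl
    cons (suc i) = refl

[]ₙ-nliftP : ∀ σ m u → (psub (nliftP σ) u) [ m ]ₙ ≡ psub σ (u [ m ]ₙ)
[]ₙ-nliftP σ m u = trans (nsub-psub _ _ u) (psub-cong (λ i → []ₙ-shiftσ m (σ i)) (u [ m ]ₙ))

[]ₙ[]ₚ-liftP-nliftP : ∀ σ m s v →
  ((psub (liftP (nliftP σ)) v) [ m ]ₙ) [ s ]ₚ ≡ psub (s ∷ₚ σ) (v [ m ]ₙ)
[]ₙ[]ₚ-liftP-nliftP σ m s v = trans (cong _[ s ]ₚ inner) ([]ₚ-liftP σ (v [ m ]ₙ) s)
  where
    inner : (psub (liftP (nliftP σ)) v) [ m ]ₙ ≡ psub (liftP σ) (v [ m ]ₙ)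
    inner = trans (nsub-psub _ _ v)
      (psub-cong (λ i → trans (nsub-liftP (m ∷σ idσ) (nliftP σ) i) (liftP-cong (λ j → []ₙ-shiftσ m (σ j)) i))
                 (v [ m ]ₙ))

[]ₙ-nliftP-liftσ : ∀ σ τ m u → (psub (nliftP σ) (nsub (liftσ τ) u)) [ m ]ₙ ≡ psub σ (nsub (m ∷σ τ) u)
[]ₙ-nliftP-liftσ σ τ m u = trans ([]ₙ-nliftP σ m (nsub (liftσ τ) u)) (cong (psub σ) ([]ₙ-liftσ m τ u))

[]ₙ[]ₚ-liftP-nliftP-liftσ : ∀ σ τ m s v →
  ((psub (liftP (nliftP σ)) (nsub (liftσ τ) v)) [ m ]ₙ) [ s ]ₚ ≡ psub (s ∷ₚ σ) (nsub (m ∷σ τ) v)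
[]ₙ[]ₚ-liftP-nliftP-liftσ σ τ m s v =
  trans ([]ₙ[]ₚ-liftP-nliftP σ m s (nsub (liftσ τ) v)) (cong (psub (s ∷ₚ σ)) ([]ₙ-liftσ m τ v))

↝-respʳ-≡ : ∀ {t u u'} → t ↝ u → u ≡ u' → t ↝ u'
↝-respʳ-≡ r refl = r

mutual
  psub-↝ : ∀ σ {t t'} → t ↝ t' → psub σ t ↝ psub σ t'
  psub-↝ σ (β u t) = ↝-respʳ-≡ (β _ _) (psub-[]ₚ σ u t)
  psub-↝ σ (βₙ u m) = ↝-respʳ-≡ (βₙ _ _) ([]ₙ-nliftP σ m u)
  psub-↝ σ (π₀-pair u₀ u₁) = π₀-pair _ _
  psub-↝ σ (π₁-pair u₀ u₁) = π₁-pair _ _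
  psub-↝ σ (case-inj₀ u t₀ t₁) = ↝-respʳ-≡ (case-inj₀ _ _ _) (psub-[]ₚ σ t₀ u)
  psub-↝ σ (case-inj₁ u t₀ t₁) = ↝-respʳ-≡ (case-inj₁ _ _ _) (psub-[]ₚ σ t₁ u)
  psub-↝ σ (ex-wit n u v) = ↝-respʳ-≡ (ex-wit _ _ _) eq
    where
      eq : ((psub (liftP (nliftP σ)) v) [ num n ]ₙ) [ psub σ u ]ₚ ≡ psub σ ((v [ num n ]ₙ) [ u ]ₚ)
      eq = trans ([]ₙ[]ₚ-liftP-nliftP σ (num n) (psub σ u) v)
                 (trans (sym ([]ₚ-liftP σ (v [ num n ]ₙ) (psub σ u))) (psub-[]ₚ σ (v [ num n ]ₙ) u))
  psub-↝ σ (R-0 u v) = R-0 _ _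
  psub-↝ σ (R-S u v n) = R-S _ _ _
  psub-↝ σ (E-app u v w) = E-app _ _ _
  psub-↝ σ (E-napp u v m) = E-napp _ _ _
  psub-↝ σ (E-π₀ u v) = E-π₀ _ _
  psub-↝ σ (E-π₁ u v) = E-π₁ _ _
  psub-↝ σ (E-case u v w₁ w₂) = E-case _ _ _ _
  psub-↝ σ (E-exE u v w) = E-exE _ _ _
  psub-↝ σ (H-true P n x) = H-true P n x
  psub-↝ σ (W-wit P n) = W-wit P n
  psub-↝ σ (E-left u v) = E-left _ _
  psub-↝ σ (E-right u v) = E-right _ _
  psub-↝ σ (app₁ u r) = app₁ _ (psub-↝ σ r)
  psub-↝ σ (app₂ t r) = app₂ _ (psub-↝ σ r)
  psub-↝ σ (napp₁ m r) = napp₁ _ (psub-↝ σ r)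
  psub-↝ σ (lam₁ r) = lam₁ (psub-↝ _ r)
  psub-↝ σ (nlam₁ r) = nlam₁ (psub-↝ _ r)
  psub-↝ σ (pair₁ u r) = pair₁ _ (psub-↝ σ r)
  psub-↝ σ (pair₂ t r) = pair₂ _ (psub-↝ σ r)
  psub-↝ σ (π₀₁ r) = π₀₁ (psub-↝ σ r)
  psub-↝ σ (π₁₁ r) = π₁₁ (psub-↝ σ r)
  psub-↝ σ (inj₀₁ r) = inj₀₁ (psub-↝ σ r)
  psub-↝ σ (inj₁₁ r) = inj₁₁ (psub-↝ σ r)
  psub-↝ σ (case₁ u v r) = case₁ _ _ (psub-↝ σ r)
  psub-↝ σ (case₂ t v r) = case₂ _ _ (psub-↝ _ r)
  psub-↝ σ (case₃ t u r) = case₃ _ _ (psub-↝ _ r)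
  psub-↝ σ (wit₁ m r) = wit₁ _ (psub-↝ σ r)
  psub-↝ σ (exE₁ u r) = exE₁ _ (psub-↝ σ r)
  psub-↝ σ (exE₂ t r) = exE₂ _ (psub-↝ _ r)
  psub-↝ σ (E₁ v r) = E₁ _ (psub-↝ σ r)
  psub-↝ σ (E₂ u r) = E₂ _ (psub-↝ σ r)
  psub-↝ σ (R₁ v m r) = R₁ _ _ (psub-↝ σ r)
  psub-↝ σ (R₂ u m r) = R₂ _ _ (psub-↝ σ r)
  psub-↝ σ (cst₁ c r) = cst₁ c (psubs-↝ σ r)

  psubs-↝ : ∀ σ {ts ts'} → ts ↝ₗ ts' → psubs σ ts ↝ₗ psubs σ ts'
  psubs-↝ σ (here ts r) = here _ (psub-↝ σ r)
  psubs-↝ σ (there t r) = there _ (psubs-↝ σ r)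

mutual
  nsub-↝ : ∀ ρ {t t'} → t ↝ t' → nsub ρ t ↝ nsub ρ t'
  nsub-↝ ρ (β u t) = ↝-respʳ-≡ (β _ _) (nsub-[]ₚ ρ u t)
  nsub-↝ ρ (βₙ u m) = ↝-respʳ-≡ (βₙ _ _) (nsub-[]ₙ ρ m u)
  nsub-↝ ρ (π₀-pair u₀ u₁) = π₀-pair _ _
  nsub-↝ ρ (π₁-pair u₀ u₁) = π₁-pair _ _
  nsub-↝ ρ (case-inj₀ u t₀ t₁) = ↝-respʳ-≡ (case-inj₀ _ _ _) (nsub-[]ₚ ρ t₀ u)
  nsub-↝ ρ (case-inj₁ u t₀ t₁) = ↝-respʳ-≡ (case-inj₁ _ _ _) (nsub-[]ₚ ρ t₁ u)
  nsub-↝ ρ (ex-wit n u v) rewrite subT-num ρ n = ↝-respʳ-≡ (ex-wit n _ _) eq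
    where
      open ≡-Reasoning
      eq : ((nsub (liftσ ρ) v) [ num n ]ₙ) [ nsub ρ u ]ₚ ≡ nsub ρ ((v [ num n ]ₙ) [ u ]ₚ)
      eq = begin
        ((nsub (liftσ ρ) v) [ num n ]ₙ) [ nsub ρ u ]ₚ
          ≡⟨ cong (λ m → ((nsub (liftσ ρ) v) [ m ]ₙ) [ nsub ρ u ]ₚ) (sym (subT-num ρ n)) ⟩
        ((nsub (liftσ ρ) v) [ subT ρ (num n) ]ₙ) [ nsub ρ u ]ₚ
          ≡⟨ cong _[ nsub ρ u ]ₚ (nsub-[]ₙ ρ (num n) v) ⟩
        (nsub ρ (v [ num n ]ₙ)) [ nsub ρ u ]ₚ
          ≡⟨ nsub-[]ₚ ρ (v [ num n ]ₙ) u ⟩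
        nsub ρ ((v [ num n ]ₙ) [ u ]ₚ) ∎
  nsub-↝ ρ (R-0 u v) = R-0 _ _
  nsub-↝ ρ (R-S u v n) rewrite subT-num ρ n = R-S _ _ _
  nsub-↝ ρ (E-app u v w) = E-app _ _ _
  nsub-↝ ρ (E-napp u v m) = E-napp _ _ _
  nsub-↝ ρ (E-π₀ u v) = E-π₀ _ _
  nsub-↝ ρ (E-π₁ u v) = E-π₁ _ _
  nsub-↝ ρ (E-case u v w₁ w₂) = E-case _ _ _ _
  nsub-↝ ρ (E-exE u v w) = E-exE _ _ _
  nsub-↝ ρ (H-true P n x) rewrite subT-num ρ n = H-true _ n true
    where
      true : TrueA (subA (num n ∷σ idσ) (subA (liftσ ρ) P))
      true = subst TrueA
        (trans (sym (subA-liftσ-[]ₙ ρ (num n) P))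
               (cong (λ m → subA (m ∷σ idσ) (subA (liftσ ρ) P)) (subT-num ρ n)))
        (TrueA-subA ρ (subA (num n ∷σ idσ) P) x)
  nsub-↝ ρ (W-wit P n) rewrite subT-num ρ n = W-wit _ n
  nsub-↝ ρ (E-left u v) = E-left _ _
  nsub-↝ ρ (E-right u v) = E-right _ _
  nsub-↝ ρ (app₁ u r) = app₁ _ (nsub-↝ ρ r)
  nsub-↝ ρ (app₂ t r) = app₂ _ (nsub-↝ ρ r)
  nsub-↝ ρ (napp₁ m r) = napp₁ _ (nsub-↝ ρ r)
  nsub-↝ ρ (lam₁ r) = lam₁ (nsub-↝ _ r)
  nsub-↝ ρ (nlam₁ r) = nlam₁ (nsub-↝ _ r)
  nsub-↝ ρ (pair₁ u r) = pair₁ _ (nsub-↝ ρ r)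
  nsub-↝ ρ (pair₂ t r) = pair₂ _ (nsub-↝ ρ r)
  nsub-↝ ρ (π₀₁ r) = π₀₁ (nsub-↝ ρ r)
  nsub-↝ ρ (π₁₁ r) = π₁₁ (nsub-↝ ρ r)
  nsub-↝ ρ (inj₀₁ r) = inj₀₁ (nsub-↝ ρ r)
  nsub-↝ ρ (inj₁₁ r) = inj₁₁ (nsub-↝ ρ r)
  nsub-↝ ρ (case₁ u v r) = case₁ _ _ (nsub-↝ ρ r)
  nsub-↝ ρ (case₂ t v r) = case₂ _ _ (nsub-↝ _ r)
  nsub-↝ ρ (case₃ t u r) = case₃ _ _ (nsub-↝ _ r)
  nsub-↝ ρ (wit₁ m r) = wit₁ _ (nsub-↝ ρ r)
  nsub-↝ ρ (exE₁ u r) = exE₁ _ (nsub-↝ ρ r)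
  nsub-↝ ρ (exE₂ t r) = exE₂ _ (nsub-↝ _ r)
  nsub-↝ ρ (E₁ v r) = E₁ _ (nsub-↝ ρ r)
  nsub-↝ ρ (E₂ u r) = E₂ _ (nsub-↝ ρ r)
  nsub-↝ ρ (R₁ v m r) = R₁ _ _ (nsub-↝ ρ r)
  nsub-↝ ρ (R₂ u m r) = R₂ _ _ (nsub-↝ ρ r)
  nsub-↝ ρ (cst₁ c r) = cst₁ c (nsubs-↝ ρ r)

  nsubs-↝ : ∀ ρ {ts ts'} → ts ↝ₗ ts' → nsubs ρ ts ↝ₗ nsubs ρ ts'
  nsubs-↝ ρ (here ts r) = here _ (nsub-↝ ρ r)
  nsubs-↝ ρ (there t r) = there _ (nsubs-↝ ρ r)

data SN[_] (Q : PT → Set) (t : PT) : Set where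
  sn : (∀ {t'} → t ↝ t' → SN[ Q ] t') → Q t → SN[ Q ] t

SNᵢ : PT → Set
SNᵢ = SN[ (λ _ → ⊤) ]

SN[]⇒SNᵢ : ∀ {Q t} → SN[ Q ] t → SNᵢ t
SN[]⇒SNᵢ (sn h _) = sn (λ r → SN[]⇒SNᵢ (h r)) tt

SNᵢ⇒SN : ∀ {t} → SNᵢ t → SN t
SNᵢ⇒SN {t} s (f , f0≡t , steps) = go s 0 f0≡t
  where
    go : ∀ {u} → SNᵢ u → ∀ k → f k ≡ u → ⊥
    go (sn h _) k refl = go (h (steps k)) (suc k) refl

SNᵢ-preimage : (f : PT → PT) → (∀ {a b} → a ↝ b → f a ↝ f b) → ∀ {t} → SNᵢ (f t) → SNᵢ t
SNᵢ-preimage f f-↝ (sn h _) = sn (λ r → SNᵢ-preimage f f-↝ (h (f-↝ r))) tt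

SNᵢ-tru : SNᵢ tru
SNᵢ-tru = sn (λ ()) tt

-- Reducibility only depends on the propositional skeleton of a formula.
data Ty : Set where
  ι : Ty
  _⇒_ _⊗_ _⊕_ : Ty → Ty → Ty
  N∀ N∃ : Ty → Ty

⌊_⌋ : Fm → Ty
⌊ atom P ⌋ = ι
⌊ A ∧' B ⌋ = ⌊ A ⌋ ⊗ ⌊ B ⌋
⌊ A ∨' B ⌋ = ⌊ A ⌋ ⊕ ⌊ B ⌋
⌊ A ⇒' B ⌋ = ⌊ A ⌋ ⇒ ⌊ B ⌋
⌊ all' A ⌋ = N∀ ⌊ A ⌋
⌊ ex' A ⌋ = N∃ ⌊ A ⌋

⌊subF⌋ : ∀ σ A → ⌊ subF σ A ⌋ ≡ ⌊ A ⌋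
⌊subF⌋ σ (atom P) = refl
⌊subF⌋ σ (A ∧' B) = cong₂ _⊗_ (⌊subF⌋ σ A) (⌊subF⌋ σ B)
⌊subF⌋ σ (A ∨' B) = cong₂ _⊕_ (⌊subF⌋ σ A) (⌊subF⌋ σ B)
⌊subF⌋ σ (A ⇒' B) = cong₂ _⇒_ (⌊subF⌋ σ A) (⌊subF⌋ σ B)
⌊subF⌋ σ (all' A) = cong N∀ (⌊subF⌋ _ A)
⌊subF⌋ σ (ex' A) = cong N∃ (⌊subF⌋ _ A)

InjRed : (PT → Set) → (PT → Set) → PT → Set
InjRed RA RB t = (∀ {u} → t ≡ inj₀ u → RA u) × (∀ {u} → t ≡ inj₁ u → RB u)

WitRed : (PT → Set) → PT → Set
WitRed RA t = ∀ {m u} → t ≡ wit m u → RA u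

-- Disjunctions and existentials are not defined by their eliminators:
-- a term of such a type may turn into an introduction only after
-- E(u,v) has been resolved, so the condition is imposed on every reduct.
Red : Ty → PT → Set
Red ι = SNᵢ
Red (A ⇒ B) t = ∀ {u} → Red A u → Red B (app t u)
Red (A ⊗ B) t = Red A (π₀ t) × Red B (π₁ t)
Red (A ⊕ B) = SN[ InjRed (Red A) (Red B) ]
Red (N∀ A) t = ∀ m → Red A (napp t m)
Red (N∃ A) = SN[ WitRed (Red A) ]

-- Variables and eliminations: an elimination applied to such a term can
-- only reduce inside its arguments.
data Neutral : PT → Set where
  neutral-pv   : ∀ {i} → Neutral (pv i)
  neutral-app  : ∀ {t u} → Neutral (app t u)
  neutral-napp : ∀ {t m} → Neutral (napp t m)
  neutral-π₀   : ∀ {t} → Neutral (π₀ t)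
  neutral-π₁   : ∀ {t} → Neutral (π₁ t)
  neutral-case : ∀ {t u v} → Neutral (case t u v)
  neutral-exE  : ∀ {t u} → Neutral (exE t u)
  neutral-R    : ∀ {u v m} → Neutral (R u v m)

neutral-≢-inj₀ : ∀ {t u} → Neutral t → t ≢ inj₀ u
neutral-≢-inj₀ () refl

neutral-≢-inj₁ : ∀ {t u} → Neutral t → t ≢ inj₁ u
neutral-≢-inj₁ () refl

neutral-≢-wit : ∀ {t m u} → Neutral t → t ≢ wit m u
neutral-≢-wit () refl

app-neutral-↝ : ∀ {t u x} (P : PT → Set) → Neutral t → app t u ↝ x →
                (∀ {t'} → t ↝ t' → P (app t' u)) → (∀ {u'} → u ↝ u' → P (app t u')) → P x
app-neutral-↝ P n (app₁ _ r) f g = f r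
app-neutral-↝ P n (app₂ _ r) f g = g r
app-neutral-↝ P () (β _ _) f g
app-neutral-↝ P () (E-app _ _ _) f g

napp-neutral-↝ : ∀ {t m x} (P : PT → Set) → Neutral t → napp t m ↝ x →
                 (∀ {t'} → t ↝ t' → P (napp t' m)) → P x
napp-neutral-↝ P n (napp₁ _ r) f = f r
napp-neutral-↝ P () (βₙ _ _) f
napp-neutral-↝ P () (E-napp _ _ _) f
napp-neutral-↝ P () (H-true _ _ _) f

π₀-neutral-↝ : ∀ {t x} (P : PT → Set) → Neutral t → π₀ t ↝ x → (∀ {t'} → t ↝ t' → P (π₀ t')) → P x
π₀-neutral-↝ P n (π₀₁ r) f = f r
π₀-neutral-↝ P () (π₀-pair _ _) f
π₀-neutral-↝ P () (E-π₀ _ _) f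

π₁-neutral-↝ : ∀ {t x} (P : PT → Set) → Neutral t → π₁ t ↝ x → (∀ {t'} → t ↝ t' → P (π₁ t')) → P x
π₁-neutral-↝ P n (π₁₁ r) f = f r
π₁-neutral-↝ P () (π₁-pair _ _) f
π₁-neutral-↝ P () (E-π₁ _ _) f

mutual
  Red⇒SNᵢ : ∀ S {t} → Red S t → SNᵢ t
  Red⇒SNᵢ ι r = r
  Red⇒SNᵢ (A ⇒ B) r = SNᵢ-preimage (λ t → app t (pv 0)) (app₁ _) (Red⇒SNᵢ B (r (pv-Red A 0)))
  Red⇒SNᵢ (A ⊗ B) (r , _) = SNᵢ-preimage π₀ π₀₁ (Red⇒SNᵢ A r)
  Red⇒SNᵢ (A ⊕ B) r = SN[]⇒SNᵢ r
  Red⇒SNᵢ (N∀ A) r = SNᵢ-preimage (λ t → napp t `0) (napp₁ _) (Red⇒SNᵢ A (r `0))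
  Red⇒SNᵢ (N∃ A) r = SN[]⇒SNᵢ r

  Red-↝ : ∀ S {t t'} → Red S t → t ↝ t' → Red S t'
  Red-↝ ι (sn h _) r = h r
  Red-↝ (A ⇒ B) rt r ru = Red-↝ B (rt ru) (app₁ _ r)
  Red-↝ (A ⊗ B) (r₀ , r₁) r = Red-↝ A r₀ (π₀₁ r) , Red-↝ B r₁ (π₁₁ r)
  Red-↝ (A ⊕ B) (sn h _) r = h r
  Red-↝ (N∀ A) rt r m = Red-↝ A (rt m) (napp₁ m r)
  Red-↝ (N∃ A) (sn h _) r = h r

  neutral⇒Red : ∀ S {t} → Neutral t → (∀ {t'} → t ↝ t' → Red S t') → Red S t
  neutral⇒Red ι n h = sn h tt
  neutral⇒Red (A ⇒ B) n h ru = neutral-app-Red A B n h (Red⇒SNᵢ A ru) ru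
  neutral⇒Red (A ⊗ B) n h =
    neutral⇒Red A neutral-π₀ (λ r → π₀-neutral-↝ (Red A) n r (proj₁ ∘ h)) ,
    neutral⇒Red B neutral-π₁ (λ r → π₁-neutral-↝ (Red B) n r (proj₂ ∘ h))
  neutral⇒Red (A ⊕ B) n h =
    sn h ((λ e → ⊥-elim (neutral-≢-inj₀ n e)) , (λ e → ⊥-elim (neutral-≢-inj₁ n e)))
  neutral⇒Red (N∀ A) n h m = neutral⇒Red A neutral-napp (λ r → napp-neutral-↝ (Red A) n r (λ r' → h r' m))
  neutral⇒Red (N∃ A) n h = sn h (λ e → ⊥-elim (neutral-≢-wit n e))

  neutral-app-Red : ∀ A B {t u} → Neutral t → (∀ {t'} → t ↝ t' → Red (A ⇒ B) t') →
                    SNᵢ u → Red A u → Red B (app t u)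
  neutral-app-Red A B n h (sn hu _) ru = neutral⇒Red B neutral-app λ r →
    app-neutral-↝ (Red B) n r (λ r' → h r' ru) (λ r' → neutral-app-Red A B n h (hu r') (Red-↝ A ru r'))

  pv-Red : ∀ S i → Red S (pv i)
  pv-Red S i = neutral⇒Red S neutral-pv (λ ())

mutual
  SN[]-E : ∀ {Q} → (∀ {u v} → Q (E u v)) → ∀ {u v} → SN[ Q ] u → SN[ Q ] v → SN[ Q ] (E u v)
  SN[]-E q su sv = sn (SN[]-E-reduct q su sv) q

  SN[]-E-reduct : ∀ {Q} → (∀ {u v} → Q (E u v)) →
                  ∀ {u v x} → SN[ Q ] u → SN[ Q ] v → E u v ↝ x → SN[ Q ] x
  SN[]-E-reduct q su sv (E-left _ _) = su
  SN[]-E-reduct q su sv (E-right _ _) = sv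
  SN[]-E-reduct q (sn hu _) sv (E₁ _ r) = SN[]-E q (hu r) sv
  SN[]-E-reduct q su (sn hv _) (E₂ _ r) = SN[]-E q su (hv r)

-- Induction on the type, for the permuted redex E(u w, v w), and on the
-- strong normalisation of u, v (and w) for reductions inside them.
mutual
  E-Red : ∀ S {u v} → Red S u → Red S v → Red S (E u v)
  E-Red ι ru rv = SN[]-E tt ru rv
  E-Red (A ⇒ B) ru rv rw = E-app-Red A B ru rv rw (Red⇒SNᵢ (A ⇒ B) ru) (Red⇒SNᵢ (A ⇒ B) rv) (Red⇒SNᵢ A rw)
  E-Red (A ⊗ B) ru rv = E-π₀-Red A B ru rv (Red⇒SNᵢ (A ⊗ B) ru) (Red⇒SNᵢ (A ⊗ B) rv) ,
                        E-π₁-Red A B ru rv (Red⇒SNᵢ (A ⊗ B) ru) (Red⇒SNᵢ (A ⊗ B) rv)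
  E-Red (A ⊕ B) ru rv = SN[]-E ((λ ()) , (λ ())) ru rv
  E-Red (N∀ A) ru rv m = E-napp-Red A m ru rv (Red⇒SNᵢ (N∀ A) ru) (Red⇒SNᵢ (N∀ A) rv)
  E-Red (N∃ A) ru rv = SN[]-E (λ ()) ru rv

  E-app-Red : ∀ A B {u v w} → Red (A ⇒ B) u → Red (A ⇒ B) v → Red A w → SNᵢ u → SNᵢ v → SNᵢ w →
              Red B (app (E u v) w)
  E-app-Red A B ru rv rw su sv sw = neutral⇒Red B neutral-app (E-app-reduct A B ru rv rw su sv sw)

  E-app-reduct : ∀ A B {u v w x} → Red (A ⇒ B) u → Red (A ⇒ B) v → Red A w → SNᵢ u → SNᵢ v → SNᵢ w →
                 app (E u v) w ↝ x → Red B x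
  E-app-reduct A B ru rv rw su sv sw (E-app _ _ _) = E-Red B (ru rw) (rv rw)
  E-app-reduct A B ru rv rw su sv sw (app₁ _ (E-left _ _)) = ru rw
  E-app-reduct A B ru rv rw su sv sw (app₁ _ (E-right _ _)) = rv rw
  E-app-reduct A B ru rv rw (sn hu _) sv sw (app₁ _ (E₁ _ r)) =
    E-app-Red A B (Red-↝ (A ⇒ B) ru r) rv rw (hu r) sv sw
  E-app-reduct A B ru rv rw su (sn hv _) sw (app₁ _ (E₂ _ r)) =
    E-app-Red A B ru (Red-↝ (A ⇒ B) rv r) rw su (hv r) sw
  E-app-reduct A B ru rv rw su sv (sn hw _) (app₂ _ r) = E-app-Red A B ru rv (Red-↝ A rw r) su sv (hw r)

  E-π₀-Red : ∀ A B {u v} → Red (A ⊗ B) u → Red (A ⊗ B) v → SNᵢ u → SNᵢ v → Red A (π₀ (E u v))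
  E-π₀-Red A B ru rv su sv = neutral⇒Red A neutral-π₀ (E-π₀-reduct A B ru rv su sv)

  E-π₀-reduct : ∀ A B {u v x} → Red (A ⊗ B) u → Red (A ⊗ B) v → SNᵢ u → SNᵢ v →
                π₀ (E u v) ↝ x → Red A x
  E-π₀-reduct A B ru rv su sv (E-π₀ _ _) = E-Red A (proj₁ ru) (proj₁ rv)
  E-π₀-reduct A B ru rv su sv (π₀₁ (E-left _ _)) = proj₁ ru
  E-π₀-reduct A B ru rv su sv (π₀₁ (E-right _ _)) = proj₁ rv
  E-π₀-reduct A B ru rv (sn hu _) sv (π₀₁ (E₁ _ r)) = E-π₀-Red A B (Red-↝ (A ⊗ B) ru r) rv (hu r) sv
  E-π₀-reduct A B ru rv su (sn hv _) (π₀₁ (E₂ _ r)) = E-π₀-Red A B ru (Red-↝ (A ⊗ B) rv r) su (hv r)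

  E-π₁-Red : ∀ A B {u v} → Red (A ⊗ B) u → Red (A ⊗ B) v → SNᵢ u → SNᵢ v → Red B (π₁ (E u v))
  E-π₁-Red A B ru rv su sv = neutral⇒Red B neutral-π₁ (E-π₁-reduct A B ru rv su sv)

  E-π₁-reduct : ∀ A B {u v x} → Red (A ⊗ B) u → Red (A ⊗ B) v → SNᵢ u → SNᵢ v →
                π₁ (E u v) ↝ x → Red B x
  E-π₁-reduct A B ru rv su sv (E-π₁ _ _) = E-Red B (proj₂ ru) (proj₂ rv)
  E-π₁-reduct A B ru rv su sv (π₁₁ (E-left _ _)) = proj₂ ru
  E-π₁-reduct A B ru rv su sv (π₁₁ (E-right _ _)) = proj₂ rv
  E-π₁-reduct A B ru rv (sn hu _) sv (π₁₁ (E₁ _ r)) = E-π₁-Red A B (Red-↝ (A ⊗ B) ru r) rv (hu r) sv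
  E-π₁-reduct A B ru rv su (sn hv _) (π₁₁ (E₂ _ r)) = E-π₁-Red A B ru (Red-↝ (A ⊗ B) rv r) su (hv r)

  E-napp-Red : ∀ A m {u v} → Red (N∀ A) u → Red (N∀ A) v → SNᵢ u → SNᵢ v → Red A (napp (E u v) m)
  E-napp-Red A m ru rv su sv = neutral⇒Red A neutral-napp (E-napp-reduct A m ru rv su sv)

  E-napp-reduct : ∀ A m {u v x} → Red (N∀ A) u → Red (N∀ A) v → SNᵢ u → SNᵢ v →
                  napp (E u v) m ↝ x → Red A x
  E-napp-reduct A m ru rv su sv (E-napp _ _ _) = E-Red A (ru m) (rv m)
  E-napp-reduct A m ru rv su sv (napp₁ _ (E-left _ _)) = ru m
  E-napp-reduct A m ru rv su sv (napp₁ _ (E-right _ _)) = rv m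
  E-napp-reduct A m ru rv (sn hu _) sv (napp₁ _ (E₁ _ r)) = E-napp-Red A m (Red-↝ (N∀ A) ru r) rv (hu r) sv
  E-napp-reduct A m ru rv su (sn hv _) (napp₁ _ (E₂ _ r)) = E-napp-Red A m ru (Red-↝ (N∀ A) rv r) su (hv r)

mutual
  π₀-pair-Red : ∀ A {a b} → SNᵢ a → SNᵢ b → Red A a → Red A (π₀ (pair a b))
  π₀-pair-Red A sa sb ra = neutral⇒Red A neutral-π₀ (π₀-pair-reduct A sa sb ra)

  π₀-pair-reduct : ∀ A {a b x} → SNᵢ a → SNᵢ b → Red A a → π₀ (pair a b) ↝ x → Red A x
  π₀-pair-reduct A sa sb ra (π₀-pair _ _) = ra
  π₀-pair-reduct A (sn ha _) sb ra (π₀₁ (pair₁ _ r)) = π₀-pair-Red A (ha r) sb (Red-↝ A ra r)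
  π₀-pair-reduct A sa (sn hb _) ra (π₀₁ (pair₂ _ r)) = π₀-pair-Red A sa (hb r) ra

mutual
  π₁-pair-Red : ∀ B {a b} → SNᵢ a → SNᵢ b → Red B b → Red B (π₁ (pair a b))
  π₁-pair-Red B sa sb rb = neutral⇒Red B neutral-π₁ (π₁-pair-reduct B sa sb rb)

  π₁-pair-reduct : ∀ B {a b x} → SNᵢ a → SNᵢ b → Red B b → π₁ (pair a b) ↝ x → Red B x
  π₁-pair-reduct B sa sb rb (π₁-pair _ _) = rb
  π₁-pair-reduct B (sn ha _) sb rb (π₁₁ (pair₁ _ r)) = π₁-pair-Red B (ha r) sb rb
  π₁-pair-reduct B sa (sn hb _) rb (π₁₁ (pair₂ _ r)) = π₁-pair-Red B sa (hb r) (Red-↝ B rb r)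

pair-Red : ∀ A B {a b} → Red A a → Red B b → Red (A ⊗ B) (pair a b)
pair-Red A B ra rb = π₀-pair-Red A (Red⇒SNᵢ A ra) (Red⇒SNᵢ B rb) ra ,
                     π₁-pair-Red B (Red⇒SNᵢ A ra) (Red⇒SNᵢ B rb) rb

RedAbs : Ty → Ty → PT → Set
RedAbs A B b = ∀ {u} → Red A u → Red B (b [ u ]ₚ)

RedAbs-↝ : ∀ A B {b b'} → RedAbs A B b → b ↝ b' → RedAbs A B b'
RedAbs-↝ A B p r ru = Red-↝ B (p ru) (psub-↝ _ r)

RedAbs⇒SNᵢ : ∀ A B {b} → RedAbs A B b → SNᵢ b
RedAbs⇒SNᵢ A B p = SNᵢ-preimage _[ pv 0 ]ₚ (psub-↝ _) (Red⇒SNᵢ B (p (pv-Red A 0)))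

mutual
  lam-app-Red : ∀ A B {b u} → SNᵢ b → SNᵢ u → RedAbs A B b → Red A u → Red B (app (lam b) u)
  lam-app-Red A B sb su pb ru = neutral⇒Red B neutral-app (lam-app-reduct A B sb su pb ru)

  lam-app-reduct : ∀ A B {b u x} → SNᵢ b → SNᵢ u → RedAbs A B b → Red A u → app (lam b) u ↝ x → Red B x
  lam-app-reduct A B sb su pb ru (β _ _) = pb ru
  lam-app-reduct A B (sn hb _) su pb ru (app₁ _ (lam₁ r)) = lam-app-Red A B (hb r) su (RedAbs-↝ A B pb r) ru
  lam-app-reduct A B sb (sn hu _) pb ru (app₂ _ r) = lam-app-Red A B sb (hu r) pb (Red-↝ A ru r)

lam-Red : ∀ A B {b} → RedAbs A B b → Red (A ⇒ B) (lam b)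
lam-Red A B pb ru = lam-app-Red A B (RedAbs⇒SNᵢ A B pb) (Red⇒SNᵢ A ru) pb ru

RedNAbs : Ty → PT → Set
RedNAbs S b = ∀ m → Red S (b [ m ]ₙ)

nlam-napp-Red : ∀ S m {b} → SNᵢ b → RedNAbs S b → Red S (napp (nlam b) m)
nlam-napp-Red S m (sn hb _) pb = neutral⇒Red S neutral-napp λ where
  (βₙ _ _) → pb m
  (napp₁ _ (nlam₁ r)) → nlam-napp-Red S m (hb r) (λ m' → Red-↝ S (pb m') (nsub-↝ _ r))

nlam-Red : ∀ S {b} → RedNAbs S b → Red (N∀ S) (nlam b)
nlam-Red S pb m = nlam-napp-Red S m (SNᵢ-preimage _[ var 0 ]ₙ (nsub-↝ _) (Red⇒SNᵢ S (pb (var 0)))) pb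

inj₀-Red : ∀ A B {a} → SNᵢ a → Red A a → Red (A ⊕ B) (inj₀ a)
inj₀-Red A B (sn h _) ra =
  sn (λ { (inj₀₁ r) → inj₀-Red A B (h r) (Red-↝ A ra r) }) ((λ { refl → ra }) , (λ ()))

inj₁-Red : ∀ A B {a} → SNᵢ a → Red B a → Red (A ⊕ B) (inj₁ a)
inj₁-Red A B (sn h _) ra =
  sn (λ { (inj₁₁ r) → inj₁-Red A B (h r) (Red-↝ B ra r) }) ((λ ()) , (λ { refl → ra }))

wit-Red : ∀ A m {a} → SNᵢ a → Red A a → Red (N∃ A) (wit m a)
wit-Red A m (sn h _) ra = sn (λ { (wit₁ _ r) → wit-Red A m (h r) (Red-↝ A ra r) }) (λ { refl → ra })

mutual
  case-Red′ : ∀ A B C {t w₁ w₂} → Red (A ⊕ B) t → SNᵢ w₁ → SNᵢ w₂ → RedAbs A C w₁ → RedAbs B C w₂ →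
              Red C (case t w₁ w₂)
  case-Red′ A B C rt s₁ s₂ p₁ p₂ = neutral⇒Red C neutral-case (case-reduct A B C rt s₁ s₂ p₁ p₂)

  case-reduct : ∀ A B C {t w₁ w₂ x} → Red (A ⊕ B) t → SNᵢ w₁ → SNᵢ w₂ → RedAbs A C w₁ → RedAbs B C w₂ →
                case t w₁ w₂ ↝ x → Red C x
  case-reduct A B C (sn h _) s₁ s₂ p₁ p₂ (case₁ _ _ r) = case-Red′ A B C (h r) s₁ s₂ p₁ p₂
  case-reduct A B C rt (sn h₁ _) s₂ p₁ p₂ (case₂ _ _ r) = case-Red′ A B C rt (h₁ r) s₂ (RedAbs-↝ A C p₁ r) p₂
  case-reduct A B C rt s₁ (sn h₂ _) p₁ p₂ (case₃ _ _ r) = case-Red′ A B C rt s₁ (h₂ r) p₁ (RedAbs-↝ B C p₂ r)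
  case-reduct A B C (sn _ (q₀ , _)) s₁ s₂ p₁ p₂ (case-inj₀ _ _ _) = p₁ (q₀ refl)
  case-reduct A B C (sn _ (_ , q₁)) s₁ s₂ p₁ p₂ (case-inj₁ _ _ _) = p₂ (q₁ refl)
  case-reduct A B C (sn h _) s₁ s₂ p₁ p₂ (E-case u v _ _) =
    E-Red C (case-Red′ A B C (h (E-left u v)) s₁ s₂ p₁ p₂)
            (case-Red′ A B C (h (E-right u v)) s₁ s₂ p₁ p₂)

case-Red : ∀ A B C {t w₁ w₂} → Red (A ⊕ B) t → RedAbs A C w₁ → RedAbs B C w₂ → Red C (case t w₁ w₂)
case-Red A B C rt p₁ p₂ = case-Red′ A B C rt (RedAbs⇒SNᵢ A C p₁) (RedAbs⇒SNᵢ B C p₂) p₁ p₂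

RedExAbs : Ty → Ty → PT → Set
RedExAbs A C v = ∀ {n u} → Red A u → Red C ((v [ num n ]ₙ) [ u ]ₚ)

RedExAbs-↝ : ∀ A C {v v'} → RedExAbs A C v → v ↝ v' → RedExAbs A C v'
RedExAbs-↝ A C p r ru = Red-↝ C (p ru) (psub-↝ _ (nsub-↝ _ r))

RedExAbs⇒SNᵢ : ∀ A C {v} → RedExAbs A C v → SNᵢ v
RedExAbs⇒SNᵢ A C p =
  SNᵢ-preimage (λ v → (v [ num 0 ]ₙ) [ pv 0 ]ₚ) (psub-↝ _ ∘ nsub-↝ _) (Red⇒SNᵢ C (p {0} (pv-Red A 0)))

mutual
  exE-Red′ : ∀ A C {t w} → Red (N∃ A) t → SNᵢ w → RedExAbs A C w → Red C (exE t w)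
  exE-Red′ A C rt sw p = neutral⇒Red C neutral-exE (exE-reduct A C rt sw p)

  exE-reduct : ∀ A C {t w x} → Red (N∃ A) t → SNᵢ w → RedExAbs A C w → exE t w ↝ x → Red C x
  exE-reduct A C (sn h _) sw p (exE₁ _ r) = exE-Red′ A C (h r) sw p
  exE-reduct A C rt (sn hw _) p (exE₂ _ r) = exE-Red′ A C rt (hw r) (RedExAbs-↝ A C p r)
  exE-reduct A C (sn _ q) sw p (ex-wit n u _) = p {n} (q refl)
  exE-reduct A C (sn h _) sw p (E-exE u v _) =
    E-Red C (exE-Red′ A C (h (E-left u v)) sw p) (exE-Red′ A C (h (E-right u v)) sw p)

exE-Red : ∀ A C {t w} → Red (N∃ A) t → RedExAbs A C w → Red C (exE t w)
exE-Red A C rt p = exE-Red′ A C rt (RedExAbs⇒SNᵢ A C p) p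

RecRed : Ty → Tm → Set
RecRed S m = ∀ {u v} → Red S u → Red (N∀ (S ⇒ S)) v → Red S (R u v m)

-- R u v m can only unfold when m is a successor, and then only to m's
-- predecessor, so induction on the term m suffices.
mutual
  R-Red-step : ∀ S m → (∀ {m'} → `S m' ≡ m → RecRed S m') →
               ∀ {u v} → SNᵢ u → SNᵢ v → Red S u → Red (N∀ (S ⇒ S)) v → Red S (R u v m)
  R-Red-step S m ih su sv ru rv = neutral⇒Red S neutral-R (R-reduct S m ih su sv ru rv)

  R-reduct : ∀ S m → (∀ {m'} → `S m' ≡ m → RecRed S m') →
             ∀ {u v x} → SNᵢ u → SNᵢ v → Red S u → Red (N∀ (S ⇒ S)) v → R u v m ↝ x → Red S x
  R-reduct S m ih su sv ru rv (R-0 _ _) = ru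
  R-reduct S m ih su sv ru rv (R-S _ _ n) = rv (num n) (ih refl ru rv)
  R-reduct S m ih (sn hu _) sv ru rv (R₁ _ _ r) = R-Red-step S m ih (hu r) sv (Red-↝ S ru r) rv
  R-reduct S m ih su (sn hv _) ru rv (R₂ _ _ r) = R-Red-step S m ih su (hv r) ru (Red-↝ (N∀ (S ⇒ S)) rv r)

mutual
  R-Red : ∀ S m → RecRed S m
  R-Red S m ru rv = R-Red-step S m (R-Red-pred S m) (Red⇒SNᵢ S ru) (Red⇒SNᵢ (N∀ (S ⇒ S)) rv) ru rv

  R-Red-pred : ∀ S m {m'} → `S m' ≡ m → RecRed S m'
  R-Red-pred S (`S m) refl = R-Red S m

data SNₗ : List PT → Set where
  snₗ : ∀ {ts} → (∀ {ts'} → ts ↝ₗ ts' → SNₗ ts') → SNₗ ts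

mutual
  SNₗ-∷ : ∀ {t ts} → SNᵢ t → SNₗ ts → SNₗ (t ∷ ts)
  SNₗ-∷ st sts = snₗ (SNₗ-∷-reduct st sts)

  SNₗ-∷-reduct : ∀ {t ts ts'} → SNᵢ t → SNₗ ts → (t ∷ ts) ↝ₗ ts' → SNₗ ts'
  SNₗ-∷-reduct (sn h _) sts (here _ r) = SNₗ-∷ (h r) sts
  SNₗ-∷-reduct st (snₗ hs) (there _ r) = SNₗ-∷ st (hs r)

All⇒SNₗ : ∀ {ts} → All SNᵢ ts → SNₗ ts
All⇒SNₗ [] = snₗ (λ ())
All⇒SNₗ (s ∷ ss) = SNₗ-∷ s (All⇒SNₗ ss)

cst-SNᵢ : ∀ c {ts} → SNₗ ts → SNᵢ (cst c ts)
cst-SNᵢ c (snₗ h) = sn (λ { (cst₁ _ r) → cst-SNᵢ c (h r) }) tt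

H-Red : ∀ P → Red (N∀ ι) (H P)
H-Red P m = sn (λ { (H-true _ _ _) → SNᵢ-tru ; (napp₁ _ ()) }) tt

wit-tru-Red : ∀ n → Red (N∃ ι) (wit (num n) tru)
wit-tru-Red n = wit-Red ι (num n) SNᵢ-tru SNᵢ-tru

W-Red : ∀ P → Red (N∃ ι) (W P)
W-Red P = sn (λ { (W-wit _ n) → wit-tru-Red n }) (λ ())

Red-⌊subF⌋ : ∀ σ A {t} → Red ⌊ subF σ A ⌋ t → Red ⌊ A ⌋ t
Red-⌊subF⌋ σ A {t} = subst (λ S → Red S t) (⌊subF⌋ σ A)

Red-⌊subF⌋⁻ : ∀ σ A {t} → Red ⌊ A ⌋ t → Red ⌊ subF σ A ⌋ t
Red-⌊subF⌋⁻ σ A {t} = subst (λ S → Red S t) (sym (⌊subF⌋ σ A))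

RedSub : List Fm → (ℕ → PT) → Set
RedSub Δ σ = ∀ {i A} → Lookup Δ i A → Red ⌊ A ⌋ (σ i)

RedSub-∷ : ∀ {Δ A σ u} → Red ⌊ A ⌋ u → RedSub Δ σ → RedSub (A ∷ Δ) (u ∷ₚ σ)
RedSub-∷ ru rs here = ru
RedSub-∷ ru rs (there l) = rs l

RedSub-shiftCtx : ∀ {Δ σ} → RedSub Δ σ → RedSub (shiftCtx Δ) σ
RedSub-shiftCtx {A ∷ Δ} rs here = Red-⌊subF⌋⁻ shiftσ A (rs here)
RedSub-shiftCtx {A ∷ Δ} rs (there l) = RedSub-shiftCtx {Δ} (rs ∘ there) l

mutual
  fundamental : ∀ {Δ Θ t A} → Typed Δ Θ t A → ∀ τ σ → RedSub Δ σ → Red ⌊ A ⌋ (psub σ (nsub τ t))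
  fundamental (tvar l) τ σ rs = rs l
  fundamental (tH _) τ σ rs = H-Red _
  fundamental (tW _) τ σ rs = W-Red _
  fundamental (tpair {A = A} {B} d e) τ σ rs =
    pair-Red ⌊ A ⌋ ⌊ B ⌋ (fundamental d τ σ rs) (fundamental e τ σ rs)
  fundamental (tπ₀ d) τ σ rs = proj₁ (fundamental d τ σ rs)
  fundamental (tπ₁ d) τ σ rs = proj₂ (fundamental d τ σ rs)
  fundamental (tapp d e) τ σ rs = fundamental d τ σ rs (fundamental e τ σ rs)
  fundamental (tlam {A = A} {B} d) τ σ rs = lam-Red ⌊ A ⌋ ⌊ B ⌋ (fundamental-abs d τ σ rs)
  fundamental (tinj₀ {A = A} {B} d) τ σ rs = inj₀-Red ⌊ A ⌋ ⌊ B ⌋ (Red⇒SNᵢ ⌊ A ⌋ r) r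
    where r = fundamental d τ σ rs
  fundamental (tinj₁ {A = A} {B} d) τ σ rs = inj₁-Red ⌊ A ⌋ ⌊ B ⌋ (Red⇒SNᵢ ⌊ B ⌋ r) r
    where r = fundamental d τ σ rs
  fundamental (tcase {A = A} {B} {C} d d₁ d₂) τ σ rs =
    case-Red ⌊ A ⌋ ⌊ B ⌋ ⌊ C ⌋ (fundamental d τ σ rs)
      (fundamental-abs d₁ τ σ rs) (fundamental-abs d₂ τ σ rs)
  fundamental (tnapp {A = A} m d) τ σ rs = Red-⌊subF⌋⁻ (m ∷σ idσ) A (fundamental d τ σ rs (subT τ m))
  fundamental (tnlam {u = u} {A} d) τ σ rs = nlam-Red ⌊ A ⌋ λ m →
    subst (Red ⌊ A ⌋) (sym ([]ₙ-nliftP-liftσ σ τ m u)) (fundamental d (m ∷σ τ) σ (RedSub-shiftCtx rs))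
  fundamental (twit {A = A} m d) τ σ rs = wit-Red ⌊ A ⌋ (subT τ m) (Red⇒SNᵢ ⌊ A ⌋ r) r
    where r = Red-⌊subF⌋ (m ∷σ idσ) A (fundamental d τ σ rs)
  fundamental (texE {t = t} {A} {C} d e) τ σ rs =
    exE-Red ⌊ A ⌋ ⌊ C ⌋ (fundamental d τ σ rs) λ {n} {u} ru →
      subst (Red ⌊ C ⌋) (sym ([]ₙ[]ₚ-liftP-nliftP-liftσ σ τ (num n) u t))
        (Red-⌊subF⌋ shiftσ C (fundamental e (num n ∷σ τ) (u ∷ₚ σ) (RedSub-∷ ru (RedSub-shiftCtx rs))))
  fundamental (tR {A = A} m d e) τ σ rs = Red-⌊subF⌋⁻ (m ∷σ idσ) A
    (R-Red ⌊ A ⌋ (subT τ m) (Red-⌊subF⌋ (`0 ∷σ idσ) A (fundamental d τ σ rs))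
      (subst (λ S → Red (N∀ (⌊ A ⌋ ⇒ S)) _) (⌊subF⌋ _ A) (fundamental e τ σ rs)))
  fundamental (tpost c [] _) τ σ rs = SNᵢ-tru
  fundamental (tpost c ds@(_ ∷ _) _) τ σ rs = cst-SNᵢ c (All⇒SNₗ (fundamentalₗ ds τ σ rs))
  fundamental (tNEM {C = C} P d e) τ σ rs = E-Red ⌊ C ⌋ (fundamental d τ σ rs) (fundamental e τ σ rs)

  fundamental-abs : ∀ {Δ Θ u A B} → Typed (A ∷ Δ) Θ u B → ∀ τ σ → RedSub Δ σ →
                    RedAbs ⌊ A ⌋ ⌊ B ⌋ (psub (liftP σ) (nsub τ u))
  fundamental-abs {u = u} {B = B} d τ σ rs {u'} ru =
    subst (Red ⌊ B ⌋) (sym ([]ₚ-liftP σ (nsub τ u) u')) (fundamental d τ (u' ∷ₚ σ) (RedSub-∷ ru rs))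

  fundamentalₗ : ∀ {Δ Θ us Ps} → TypedL Δ Θ us Ps → ∀ τ σ → RedSub Δ σ → All SNᵢ (psubs σ (nsubs τ us))
  fundamentalₗ [] τ σ rs = []
  fundamentalₗ (d ∷ ds) τ σ rs = fundamental d τ σ rs ∷ fundamentalₗ ds τ σ rs

mainTheorem5 : (Δ Θ : List Fm) (t : PT) (A : Fm) → Typed Δ Θ t A → SN t
mainTheorem5 Δ Θ t A d = SNᵢ⇒SN (subst SNᵢ (trans (psub-id _) (nsub-id t)) (Red⇒SNᵢ ⌊ A ⌋ red))
  where
    red : Red ⌊ A ⌋ (psub pv (nsub idσ t))
    red = fundamental d idσ pv (λ {i} _ → pv-Red _ i)
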